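{- Fix integers $q,r\ge1$, nonnegative integers $i,s$, and a residue $\eta\in\{0,\dots,qr-1\}$. For $\mu=qr[\mu]+\eta$ with $[\mu]$ a nonnegative integer, consider the polynomial in $l$ $$\frac{\Delta_q^{i+[\mu]_q}}{q^{i+[\mu]_q}(i+[\mu]_q)!}\Big(\frac{(l+\mu)^{r+1}-l^{r+1}}{\mu(r+1)}\Big)^{s+[\mu]}.$$ This expression is polynomial in $[\mu]$ (i.e. there is a polynomial in $l$ and $[\mu]$ agreeing with it for all nonnegative integers $[\mu]$), of degree $2rs-2i-2\langle[\mu]_q\rangle_r$ in $[\mu]$.
   Context: For an integer $\mu$ and a positive integer $a$ write $\mu=a[\mu]_a+\langle\mu\rangle_a$ with $0\le\langle\mu\rangle_a<a$; $[\mu]=[\mu]_{qr}$. Note $\langle[\mu]_q\rangle_r=\lfloor\eta/q\rfloor$ depends only on $\eta$. $\Delta_q$ is the backward difference operator in $l$: $(\Delta_qf)(l)=f(l)-f(l-q)$. -}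

module Defs where

open import Data.Nat as ℕ using (ℕ; zero; suc; _≤_; _<_; NonZero)
open import Data.Nat.Properties using (m^n≢0; _!≢0)
open import Data.Integer as ℤ using (ℤ; +_)
open import Data.Rational using (ℚ; 0ℚ; 1ℚ; _+_; _*_; _-_; _/_)
open import Data.Product using (Σ; ∃; _×_)
open import Relation.Binary.PropositionalEquality using (_≡_; _≢_)

_^ℚ_ : ℚ → ℕ → ℚ
x ^ℚ zero  = 1ℚ
x ^ℚ suc n = x * (x ^ℚ n)

ℕ→ℚ : ℕ → ℚ
ℕ→ℚ n = (+ n) / 1

sumTo : ℕ → (ℕ → ℚ) → ℚ
sumTo zero    f = f 0
sumTo (suc n) f = sumTo n f + f (suc n)

Δ : ℚ → (ℚ → ℚ) → (ℚ → ℚ)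
Δ h f l = f l - f (l - h)

Δ^ : ℚ → ℕ → (ℚ → ℚ) → (ℚ → ℚ)
Δ^ h zero    f = f
Δ^ h (suc k) f = Δ h (Δ^ h k f)

-- P_{r,μ}(x) = ((x+μ)^{r+1} - x^{r+1}) / (μ (r+1)), a polynomial in x;
-- for μ = 0 the polynomial quotient is x^r (its value as a polynomial).
Pμ : ℕ → ℕ → ℚ → ℚ
Pμ r zero      x = x ^ℚ r
Pμ r (suc n)   x =
  (((x + ℕ→ℚ (suc n)) ^ℚ suc r) - (x ^ℚ suc r)) * ((+ 1) / (suc n ℕ.* suc r))

muOf : (q r η m : ℕ) → ℕ
muOf q r η m = q ℕ.* r ℕ.* m ℕ.+ η

floorQ : (q μ : ℕ) → .{{NonZero q}} → ℕ
floorQ q μ = μ ℕ./ q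

expr : (q r i s η : ℕ) → .{{NonZero q}} → (m : ℕ) → ℚ → ℚ
expr q r i s η m l =
  let μ = muOf q r η m
      k = i ℕ.+ floorQ q μ
  in ((+ 1) / (q ℕ.^ k)) {{m^n≢0 q k}} * ((+ 1) / (k ℕ.!)) {{k !≢0}}
       * Δ^ (ℕ→ℚ q) k (λ x → Pμ r μ x ^ℚ (s ℕ.+ m)) l

evalPoly2 : (D : ℕ) → (ℕ → ℕ → ℚ) → ℚ → ℚ → ℚ
evalPoly2 D c l m =
  sumTo D (λ a → sumTo (D ℕ.∸ a) (λ b → c a b * (l ^ℚ a) * (m ^ℚ b)))

-- "f is a polynomial in l and m of (total) degree exactly D" (D : ℤ);
-- by convention a negative degree means f is identically zero.
IsPolyOfDegree : ℤ → (ℕ → ℚ → ℚ) → Set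
IsPolyOfDegree (+ D) f =
  Σ (ℕ → ℕ → ℚ) λ c →
    (∀ (m : ℕ) (l : ℚ) → f m l ≡ evalPoly2 D c l (ℕ→ℚ m))
    × ∃ λ a → a ≤ D × c a (D ℕ.∸ a) ≢ 0ℚ
IsPolyOfDegree ℤ.-[1+ _ ] f = ∀ (m : ℕ) (l : ℚ) → f m l ≡ 0ℚ

-- Put μ = q r m + η (so m = [μ]), c₀ = i + ⌊η/q⌋ and d = r s − c₀.  Then [μ]_q = r m + ⌊η/q⌋,
-- so the expression is D_k (P_{r,μ}^(s+m)) at l, with D_k = Δ_q^k / (q^k k!) and k = r m + c₀,
-- and P_{r,μ}^(s+m) has degree r (s + m) = k + d.
-- Write P_{r,μ}(x)^n = Σ_t B_n(t) μ^t x^(n r − t): B_n(0) = 1 and B_{n+1}(t) − B_n(t) only involves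
-- B_n(t′) with t′ < t, so B_n(t) is a polynomial of degree ≤ t in n.
-- D_k kills x^j for j < k, and D_k x^(k+w) = Σ_{a ≤ w} h_{w,a}(k) l^a, where h_{w,a} is a polynomial
-- of degree ≤ 2w − a in k (again by summing a recursion in k) and h_{w,w}(k) = C(k + w, w).
-- So the expression is Σ_{a ≤ d} l^a Σ_t B_{s+m}(t) μ^t h_{d−t,a}(k), where the coefficient of l^a has
-- degree ≤ t + t + (2(d − t) − a) = 2d − a in m, and the coefficient of l^d m^d comes from t = 0 alone:
-- it is the leading coefficient r^d/d! of C(r m + r s, d).  If d < 0 every power of x is killed.
-- Degrees in m are bounded in the binomial basis C(m, b), where summation over m raises the degree
-- by one, and converted to monomials at the end.

module Submission where

open import Defs

module _ where

  open import Algebra.Bundles using (CommutativeMonoid)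
  open import Data.Nat as ℕ using (ℕ; zero; suc; _≤_; _<_; z≤n; s≤s; NonZero; _!)
  import Data.Nat.Properties as ℕ
  open import Data.Nat.Combinatorics using (_C_; nC1≡n; nCn≡1; nCk+nC[k+1]≡[n+1]C[k+1]; k>n⇒nCk≡0)
  open import Data.Nat.DivMod using (+-distrib-/-∣ˡ; m*n/n≡m)
  open import Data.Nat.Divisibility using (n∣m*n)
  open import Data.Nat.Induction using (<-rec)
  import Data.Nat.Solver as ℕ-Solver
  open import Data.Integer as ℤ using ()
  import Data.Integer.Properties as ℤ
  import Data.Integer.Solver as ℤ-Solver
  open import Data.Product using (_,_)
  open import Data.Rational using (ℚ; 0ℚ; 1ℚ; _+_; _*_; _-_; -_; _/_; toℚᵘ)
  open import Data.Rational.Properties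
  open import Data.Rational.Solver using (module +-*-Solver)
  import Data.Rational.Unnormalised as ℚᵘ
  import Data.Rational.Unnormalised.Properties as ℚᵘₚ
  open import Data.Sum using (inj₁; inj₂)
  open import Relation.Binary.PropositionalEquality
  open import Relation.Nullary using (Dec; yes; no; contradiction)
  import Algebra.Properties.CommutativeSemigroup (CommutativeMonoid.commutativeSemigroup *-1-commutativeMonoid) as ℚ*
  import Algebra.Properties.CommutativeSemigroup (CommutativeMonoid.commutativeSemigroup +-0-commutativeMonoid) as ℚ+

  -- The embedding ℕ → ℚ and reciprocals

  ℕ→ℚ-toℚᵘ : ∀ n → toℚᵘ (ℕ→ℚ n) ℚᵘ.≃ ℚᵘ.mkℚᵘ (ℤ.+ n) 0
  ℕ→ℚ-toℚᵘ n = toℚᵘ-fromℚᵘ (ℚᵘ.mkℚᵘ (ℤ.+ n) 0)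

  ℕ→ℚ-suc : ∀ n → ℕ→ℚ (suc n) ≡ 1ℚ + ℕ→ℚ n
  ℕ→ℚ-suc n = toℚᵘ-injective (begin-equality
    toℚᵘ (ℕ→ℚ (suc n))                ≃⟨ ℕ→ℚ-toℚᵘ (suc n) ⟩
    ℚᵘ.mkℚᵘ (ℤ.+ suc n) 0             ≃⟨ ℚᵘ.*≡* (cross-multiplied (ℤ.+ n)) ⟩
    ℚᵘ.1ℚᵘ ℚᵘ.+ ℚᵘ.mkℚᵘ (ℤ.+ n) 0      ≃⟨ ℚᵘₚ.+-cong (toℚᵘ-fromℚᵘ ℚᵘ.1ℚᵘ) (ℕ→ℚ-toℚᵘ n) ⟨
    toℚᵘ 1ℚ ℚᵘ.+ toℚᵘ (ℕ→ℚ n)          ≃⟨ toℚᵘ-homo-+ 1ℚ (ℕ→ℚ n) ⟨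
    toℚᵘ (1ℚ + ℕ→ℚ n)                 ∎)
    where
    open ℚᵘₚ.≤-Reasoning
    open ℤ-Solver.+-*-Solver
    cross-multiplied : ∀ n → (ℤ.+ 1 ℤ.+ n) ℤ.* ℤ.+ 1 ≡ (ℤ.+ 1 ℤ.* ℤ.+ 1 ℤ.+ n ℤ.* ℤ.+ 1) ℤ.* ℤ.+ 1
    cross-multiplied = solve 1 (λ n → (con (ℤ.+ 1) :+ n) :* con (ℤ.+ 1)
                                   := (con (ℤ.+ 1) :* con (ℤ.+ 1) :+ n :* con (ℤ.+ 1)) :* con (ℤ.+ 1)) refl

  ℕ→ℚ-homo-+ : ∀ m n → ℕ→ℚ (m ℕ.+ n) ≡ ℕ→ℚ m + ℕ→ℚ n
  ℕ→ℚ-homo-+ zero    n = sym (+-identityˡ (ℕ→ℚ n))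
  ℕ→ℚ-homo-+ (suc m) n = begin
    ℕ→ℚ (suc (m ℕ.+ n))      ≡⟨ ℕ→ℚ-suc (m ℕ.+ n) ⟩
    1ℚ + ℕ→ℚ (m ℕ.+ n)       ≡⟨ cong (1ℚ +_) (ℕ→ℚ-homo-+ m n) ⟩
    1ℚ + (ℕ→ℚ m + ℕ→ℚ n)     ≡⟨ +-assoc 1ℚ (ℕ→ℚ m) (ℕ→ℚ n) ⟨
    (1ℚ + ℕ→ℚ m) + ℕ→ℚ n     ≡⟨ cong (_+ ℕ→ℚ n) (ℕ→ℚ-suc m) ⟨
    ℕ→ℚ (suc m) + ℕ→ℚ n      ∎
    where open ≡-Reasoning

  ℕ→ℚ-homo-* : ∀ m n → ℕ→ℚ (m ℕ.* n) ≡ ℕ→ℚ m * ℕ→ℚ n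
  ℕ→ℚ-homo-* zero    n = sym (*-zeroˡ (ℕ→ℚ n))
  ℕ→ℚ-homo-* (suc m) n = begin
    ℕ→ℚ (n ℕ.+ m ℕ.* n)           ≡⟨ ℕ→ℚ-homo-+ n (m ℕ.* n) ⟩
    ℕ→ℚ n + ℕ→ℚ (m ℕ.* n)         ≡⟨ cong (ℕ→ℚ n +_) (ℕ→ℚ-homo-* m n) ⟩
    ℕ→ℚ n + ℕ→ℚ m * ℕ→ℚ n         ≡⟨ cong (_+ ℕ→ℚ m * ℕ→ℚ n) (*-identityˡ (ℕ→ℚ n)) ⟨
    1ℚ * ℕ→ℚ n + ℕ→ℚ m * ℕ→ℚ n    ≡⟨ *-distribʳ-+ (ℕ→ℚ n) 1ℚ (ℕ→ℚ m) ⟨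
    (1ℚ + ℕ→ℚ m) * ℕ→ℚ n          ≡⟨ cong (_* ℕ→ℚ n) (ℕ→ℚ-suc m) ⟨
    ℕ→ℚ (suc m) * ℕ→ℚ n           ∎
    where open ≡-Reasoning

  ℕ→ℚ-homo-^ : ∀ m n → ℕ→ℚ (m ℕ.^ n) ≡ ℕ→ℚ m ^ℚ n
  ℕ→ℚ-homo-^ m zero    = refl
  ℕ→ℚ-homo-^ m (suc n) = trans (ℕ→ℚ-homo-* m (m ℕ.^ n)) (cong (ℕ→ℚ m *_) (ℕ→ℚ-homo-^ m n))

  ℕ→ℚ-affine : ∀ α c m → ℕ→ℚ (α ℕ.* m ℕ.+ c) ≡ ℕ→ℚ α * ℕ→ℚ m + ℕ→ℚ c
  ℕ→ℚ-affine α c m = trans (ℕ→ℚ-homo-+ (α ℕ.* m) c) (cong (_+ ℕ→ℚ c) (ℕ→ℚ-homo-* α m))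

  ℕ→ℚ-injective : ∀ {m n} → ℕ→ℚ m ≡ ℕ→ℚ n → m ≡ n
  ℕ→ℚ-injective {m} {n} eq
    with ℚᵘₚ.≃-trans (ℚᵘₚ.≃-sym (ℕ→ℚ-toℚᵘ m)) (ℚᵘₚ.≃-trans (toℚᵘ-cong eq) (ℕ→ℚ-toℚᵘ n))
  ... | ℚᵘ.*≡* eq′ = ℤ.+-injective (trans (sym (ℤ.*-identityʳ (ℤ.+ m))) (trans eq′ (ℤ.*-identityʳ (ℤ.+ n))))

  1/ℕ : (n : ℕ) .{{_ : NonZero n}} → ℚ
  1/ℕ n = ℤ.+ 1 / n

  1/ℕ-inverseʳ : ∀ n .{{_ : NonZero n}} → ℕ→ℚ n * 1/ℕ n ≡ 1ℚ
  1/ℕ-inverseʳ (suc n) = toℚᵘ-injective (begin-equality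
    toℚᵘ (ℕ→ℚ (suc n) * 1/ℕ (suc n))              ≃⟨ toℚᵘ-homo-* (ℕ→ℚ (suc n)) (1/ℕ (suc n)) ⟩
    toℚᵘ (ℕ→ℚ (suc n)) ℚᵘ.* toℚᵘ (1/ℕ (suc n))
      ≃⟨ ℚᵘₚ.*-cong (ℕ→ℚ-toℚᵘ (suc n)) (toℚᵘ-fromℚᵘ (ℚᵘ.mkℚᵘ (ℤ.+ 1) n)) ⟩
    ℚᵘ.mkℚᵘ (ℤ.+ suc n) 0 ℚᵘ.* ℚᵘ.mkℚᵘ (ℤ.+ 1) n  ≃⟨ ℚᵘ.*≡* (cross-multiplied (ℤ.+ n)) ⟩
    ℚᵘ.1ℚᵘ                                        ≃⟨ toℚᵘ-fromℚᵘ ℚᵘ.1ℚᵘ ⟨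
    toℚᵘ 1ℚ                                       ∎)
    where
    open ℚᵘₚ.≤-Reasoning
    open ℤ-Solver.+-*-Solver
    cross-multiplied : ∀ n → (ℤ.+ 1 ℤ.+ n) ℤ.* ℤ.+ 1 ℤ.* ℤ.+ 1 ≡ ℤ.+ 1 ℤ.* (ℤ.+ 1 ℤ.* (ℤ.+ 1 ℤ.+ n))
    cross-multiplied = solve 1 (λ n → (con (ℤ.+ 1) :+ n) :* con (ℤ.+ 1) :* con (ℤ.+ 1)
                                   := con (ℤ.+ 1) :* (con (ℤ.+ 1) :* (con (ℤ.+ 1) :+ n))) refl

  1/ℕ-inverseˡ : ∀ n .{{_ : NonZero n}} → 1/ℕ n * ℕ→ℚ n ≡ 1ℚ
  1/ℕ-inverseˡ n = trans (*-comm (1/ℕ n) (ℕ→ℚ n)) (1/ℕ-inverseʳ n)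

  1/ℕ-cancelˡ : ∀ n .{{_ : NonZero n}} x → 1/ℕ n * (ℕ→ℚ n * x) ≡ x
  1/ℕ-cancelˡ n x = trans (sym (*-assoc (1/ℕ n) (ℕ→ℚ n) x)) (trans (cong (_* x) (1/ℕ-inverseˡ n)) (*-identityˡ x))

  inverse-unique : ∀ {a x y} → a * x ≡ 1ℚ → a * y ≡ 1ℚ → x ≡ y
  inverse-unique {a} {x} {y} ax≡1 ay≡1 = begin
    x              ≡⟨ *-identityʳ x ⟨
    x * 1ℚ         ≡⟨ cong (x *_) ay≡1 ⟨
    x * (a * y)    ≡⟨ *-assoc x a y ⟨
    (x * a) * y    ≡⟨ cong (_* y) (trans (*-comm x a) ax≡1) ⟩
    1ℚ * y         ≡⟨ *-identityˡ y ⟩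
    y              ∎
    where open ≡-Reasoning

  1/ℕ-homo-* : ∀ m n .{{_ : NonZero m}} .{{_ : NonZero n}} →
               1/ℕ (m ℕ.* n) {{ℕ.m*n≢0 m n}} ≡ 1/ℕ m * 1/ℕ n
  1/ℕ-homo-* m n = inverse-unique {ℕ→ℚ (m ℕ.* n)} (1/ℕ-inverseʳ (m ℕ.* n) {{ℕ.m*n≢0 m n}}) (begin
    ℕ→ℚ (m ℕ.* n) * (1/ℕ m * 1/ℕ n)        ≡⟨ cong (_* (1/ℕ m * 1/ℕ n)) (ℕ→ℚ-homo-* m n) ⟩
    (ℕ→ℚ m * ℕ→ℚ n) * (1/ℕ m * 1/ℕ n)      ≡⟨ ℚ*.interchange (ℕ→ℚ m) (ℕ→ℚ n) (1/ℕ m) (1/ℕ n) ⟩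
    (ℕ→ℚ m * 1/ℕ m) * (ℕ→ℚ n * 1/ℕ n)      ≡⟨ cong₂ _*_ (1/ℕ-inverseʳ m) (1/ℕ-inverseʳ n) ⟩
    1ℚ * 1ℚ                                ≡⟨⟩
    1ℚ                                     ∎)
    where open ≡-Reasoning

  ℕ→ℚ-*-1/ℕ-≢0 : ∀ m n .{{_ : NonZero m}} .{{_ : NonZero n}} → ℕ→ℚ m * 1/ℕ n ≢ 0ℚ
  ℕ→ℚ-*-1/ℕ-≢0 m n {{m≢0}} eq = ℕ.≢-nonZero⁻¹ m {{m≢0}} (ℕ→ℚ-injective (begin
    ℕ→ℚ m                          ≡⟨ *-identityʳ (ℕ→ℚ m) ⟨
    ℕ→ℚ m * 1ℚ                     ≡⟨ cong (ℕ→ℚ m *_) (1/ℕ-inverseˡ n) ⟨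
    ℕ→ℚ m * (1/ℕ n * ℕ→ℚ n)        ≡⟨ *-assoc (ℕ→ℚ m) (1/ℕ n) (ℕ→ℚ n) ⟨
    ℕ→ℚ m * 1/ℕ n * ℕ→ℚ n          ≡⟨ cong (_* ℕ→ℚ n) eq ⟩
    0ℚ * ℕ→ℚ n                     ≡⟨ *-zeroˡ (ℕ→ℚ n) ⟩
    ℕ→ℚ 0                          ∎))
    where open ≡-Reasoning

  ^ℚ-+ : ∀ x m n → x ^ℚ (m ℕ.+ n) ≡ x ^ℚ m * x ^ℚ n
  ^ℚ-+ x zero    n = sym (*-identityˡ (x ^ℚ n))
  ^ℚ-+ x (suc m) n = trans (cong (x *_) (^ℚ-+ x m n)) (sym (*-assoc x (x ^ℚ m) (x ^ℚ n)))

  -- Finite sums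

  sumTo-cong≤ : ∀ n {f g : ℕ → ℚ} → (∀ j → j ≤ n → f j ≡ g j) → sumTo n f ≡ sumTo n g
  sumTo-cong≤ zero    f≡g = f≡g 0 z≤n
  sumTo-cong≤ (suc n) f≡g =
    cong₂ _+_ (sumTo-cong≤ n (λ j j≤n → f≡g j (ℕ.m≤n⇒m≤1+n j≤n))) (f≡g (suc n) ℕ.≤-refl)

  sumTo-cong : ∀ n {f g : ℕ → ℚ} → (∀ j → f j ≡ g j) → sumTo n f ≡ sumTo n g
  sumTo-cong n f≡g = sumTo-cong≤ n (λ j _ → f≡g j)

  sumTo-zero : ∀ n {f : ℕ → ℚ} → (∀ j → j ≤ n → f j ≡ 0ℚ) → sumTo n f ≡ 0ℚ
  sumTo-zero zero    f≡0 = f≡0 0 z≤n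
  sumTo-zero (suc n) f≡0 =
    cong₂ _+_ (sumTo-zero n (λ j j≤n → f≡0 j (ℕ.m≤n⇒m≤1+n j≤n))) (f≡0 (suc n) ℕ.≤-refl)

  sumTo-+ : ∀ n (f g : ℕ → ℚ) → sumTo n (λ j → f j + g j) ≡ sumTo n f + sumTo n g
  sumTo-+ zero    f g = refl
  sumTo-+ (suc n) f g = trans (cong (_+ (f (suc n) + g (suc n))) (sumTo-+ n f g))
                              (ℚ+.interchange (sumTo n f) (sumTo n g) (f (suc n)) (g (suc n)))

  *-distribˡ-sumTo : ∀ n c (f : ℕ → ℚ) → c * sumTo n f ≡ sumTo n (λ j → c * f j)
  *-distribˡ-sumTo zero    c f = refl
  *-distribˡ-sumTo (suc n) c f =
    trans (*-distribˡ-+ c (sumTo n f) (f (suc n))) (cong (_+ c * f (suc n)) (*-distribˡ-sumTo n c f))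

  *-distribʳ-sumTo : ∀ n c (f : ℕ → ℚ) → sumTo n f * c ≡ sumTo n (λ j → f j * c)
  *-distribʳ-sumTo n c f =
    trans (*-comm (sumTo n f) c) (trans (*-distribˡ-sumTo n c f) (sumTo-cong n (λ j → *-comm c (f j))))

  neg-sumTo : ∀ n (f : ℕ → ℚ) → - sumTo n f ≡ sumTo n (λ j → - f j)
  neg-sumTo zero    f = refl
  neg-sumTo (suc n) f = trans (neg-distrib-+ (sumTo n f) (f (suc n))) (cong (_+ - f (suc n)) (neg-sumTo n f))

  sumTo-suc : ∀ n (f : ℕ → ℚ) → sumTo (suc n) f ≡ f 0 + sumTo n (λ j → f (suc j))
  sumTo-suc zero    f = refl
  sumTo-suc (suc n) f = trans (cong (_+ f (suc (suc n))) (sumTo-suc n f)) (+-assoc (f 0) _ _)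

  sumTo-comm : ∀ m n (F : ℕ → ℕ → ℚ) →
               sumTo m (λ a → sumTo n (F a)) ≡ sumTo n (λ b → sumTo m (λ a → F a b))
  sumTo-comm zero    n F = refl
  sumTo-comm (suc m) n F = trans (cong (_+ sumTo n (F (suc m))) (sumTo-comm m n F))
                                 (sym (sumTo-+ n (λ b → sumTo m (λ a → F a b)) (F (suc m))))

  sumTo-extend : ∀ {m n} {f : ℕ → ℚ} → m ≤ n → (∀ j → m < j → j ≤ n → f j ≡ 0ℚ) →
                 sumTo n f ≡ sumTo m f
  sumTo-extend {n = zero}  z≤n _   = refl
  sumTo-extend {m} {suc n} {f} m≤1+n f≡0 with ℕ.m≤n⇒m<n∨m≡n m≤1+n
  ... | inj₂ refl     = refl
  ... | inj₁ (s≤s m≤n) = begin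
    sumTo n f + f (suc n)   ≡⟨ cong₂ _+_ (sumTo-extend m≤n (λ j m<j j≤n → f≡0 j m<j (ℕ.m≤n⇒m≤1+n j≤n)))
                                         (f≡0 (suc n) (s≤s m≤n) ℕ.≤-refl) ⟩
    sumTo m f + 0ℚ          ≡⟨ +-identityʳ (sumTo m f) ⟩
    sumTo m f               ∎
    where open ≡-Reasoning

  δ : ℕ → ℕ → ℚ
  δ i j with i ℕ.≟ j
  ... | yes _ = 1ℚ
  ... | no  _ = 0ℚ

  δ-refl : ∀ i → δ i i ≡ 1ℚ
  δ-refl i with i ℕ.≟ i
  ... | yes _  = refl
  ... | no i≢i = contradiction refl i≢i

  δ-≢ : ∀ {i j} → i ≢ j → δ i j ≡ 0ℚ
  δ-≢ {i} {j} i≢j with i ℕ.≟ j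
  ... | yes i≡j = contradiction i≡j i≢j
  ... | no  _   = refl

  sumTo-δ : ∀ n (f : ℕ → ℚ) → sumTo n (λ j → δ n j * f j) ≡ f n
  sumTo-δ zero    f = trans (cong (_* f 0) (δ-refl 0)) (*-identityˡ (f 0))
  sumTo-δ (suc n) f = begin
    sumTo n (λ j → δ (suc n) j * f j) + δ (suc n) (suc n) * f (suc n)
      ≡⟨ cong₂ _+_ (sumTo-zero n (λ j j≤n → trans (cong (_* f j) (δ-≢ (ℕ.>⇒≢ (s≤s j≤n)))) (*-zeroˡ (f j))))
                   (trans (cong (_* f (suc n)) (δ-refl (suc n))) (*-identityˡ (f (suc n)))) ⟩
    0ℚ + f (suc n)
      ≡⟨ +-identityˡ (f (suc n)) ⟩
    f (suc n) ∎
    where open ≡-Reasoning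

  -- Binomial coefficients

  C-absorption : ∀ m b → m ℕ.* (m C b) ≡ suc b ℕ.* (m C suc b) ℕ.+ b ℕ.* (m C b)
  C-absorption zero    zero    = refl
  C-absorption zero    (suc b) = sym (cong₂ ℕ._+_ (ℕ.*-zeroʳ (suc (suc b))) (ℕ.*-zeroʳ (suc b)))
  C-absorption (suc m) zero    = begin
    suc m ℕ.* 1                ≡⟨ ℕ.*-identityʳ (suc m) ⟩
    suc m                      ≡⟨ nC1≡n (suc m) ⟨
    suc m C 1                  ≡⟨ ℕ.+-identityʳ (suc m C 1) ⟨
    suc m C 1 ℕ.+ 0            ≡⟨ cong (ℕ._+ 0) (ℕ.*-identityˡ (suc m C 1)) ⟨
    1 ℕ.* (suc m C 1) ℕ.+ 0    ∎
    where open ≡-Reasoning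
  C-absorption (suc m) (suc b) = begin
    suc m ℕ.* (suc m C suc b)
      ≡⟨ cong (suc m ℕ.*_) (nCk+nC[k+1]≡[n+1]C[k+1] m b) ⟨
    suc m ℕ.* (x ℕ.+ y)
      ≡⟨ expand m x y ⟩
    m ℕ.* x ℕ.+ m ℕ.* y ℕ.+ x ℕ.+ y
      ≡⟨ cong (λ t → t ℕ.+ x ℕ.+ y) (cong₂ ℕ._+_ (C-absorption m b) (C-absorption m (suc b))) ⟩
    (suc b ℕ.* y ℕ.+ b ℕ.* x) ℕ.+ (suc (suc b) ℕ.* z ℕ.+ suc b ℕ.* y) ℕ.+ x ℕ.+ y
      ≡⟨ regroup b x y z ⟩
    suc (suc b) ℕ.* (y ℕ.+ z) ℕ.+ suc b ℕ.* (x ℕ.+ y)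
      ≡⟨ cong₂ (λ u v → suc (suc b) ℕ.* u ℕ.+ suc b ℕ.* v)
               (nCk+nC[k+1]≡[n+1]C[k+1] m (suc b)) (nCk+nC[k+1]≡[n+1]C[k+1] m b) ⟩
    suc (suc b) ℕ.* (suc m C suc (suc b)) ℕ.+ suc b ℕ.* (suc m C suc b)
      ∎
    where
    open ≡-Reasoning
    open ℕ-Solver.+-*-Solver
    x : ℕ
    x = m C b
    y : ℕ
    y = m C suc b
    z : ℕ
    z = m C suc (suc b)
    expand : ∀ m x y → suc m ℕ.* (x ℕ.+ y) ≡ m ℕ.* x ℕ.+ m ℕ.* y ℕ.+ x ℕ.+ y
    expand = solve 3 (λ m x y → (con 1 :+ m) :* (x :+ y) := m :* x :+ m :* y :+ x :+ y) refl
    regroup : ∀ b x y z → (suc b ℕ.* y ℕ.+ b ℕ.* x) ℕ.+ (suc (suc b) ℕ.* z ℕ.+ suc b ℕ.* y) ℕ.+ x ℕ.+ y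
                          ≡ suc (suc b) ℕ.* (y ℕ.+ z) ℕ.+ suc b ℕ.* (x ℕ.+ y)
    regroup = solve 4 (λ b x y z → ((con 1 :+ b) :* y :+ b :* x) :+ ((con 2 :+ b) :* z :+ (con 1 :+ b) :* y) :+ x :+ y
                                   := (con 2 :+ b) :* (y :+ z) :+ (con 1 :+ b) :* (x :+ y)) refl

  ℕ→ℚ-C-absorption : ∀ m b → ℕ→ℚ m * ℕ→ℚ (m C b) ≡ ℕ→ℚ (suc b) * ℕ→ℚ (m C suc b) + ℕ→ℚ b * ℕ→ℚ (m C b)
  ℕ→ℚ-C-absorption m b = begin
    ℕ→ℚ m * ℕ→ℚ (m C b)                              ≡⟨ ℕ→ℚ-homo-* m (m C b) ⟨
    ℕ→ℚ (m ℕ.* (m C b))                              ≡⟨ cong ℕ→ℚ (C-absorption m b) ⟩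
    ℕ→ℚ (suc b ℕ.* (m C suc b) ℕ.+ b ℕ.* (m C b))    ≡⟨ ℕ→ℚ-homo-+ (suc b ℕ.* (m C suc b)) (b ℕ.* (m C b)) ⟩
    ℕ→ℚ (suc b ℕ.* (m C suc b)) + ℕ→ℚ (b ℕ.* (m C b))
      ≡⟨ cong₂ _+_ (ℕ→ℚ-homo-* (suc b) (m C suc b)) (ℕ→ℚ-homo-* b (m C b)) ⟩
    ℕ→ℚ (suc b) * ℕ→ℚ (m C suc b) + ℕ→ℚ b * ℕ→ℚ (m C b) ∎
    where open ≡-Reasoning

  C-suc : ∀ m b → ℕ→ℚ (m C suc b) ≡ 1/ℕ (suc b) * ((ℕ→ℚ m - ℕ→ℚ b) * ℕ→ℚ (m C b))
  C-suc m b = sym (begin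
    1/ℕ (suc b) * ((ℕ→ℚ m - ℕ→ℚ b) * X)    ≡⟨ cong (1/ℕ (suc b) *_) absorption ⟩
    1/ℕ (suc b) * (ℕ→ℚ (suc b) * Y)        ≡⟨ 1/ℕ-cancelˡ (suc b) Y ⟩
    Y                                      ∎)
    where
    open ≡-Reasoning
    open +-*-Solver
    X : ℚ
    X = ℕ→ℚ (m C b)
    Y : ℚ
    Y = ℕ→ℚ (m C suc b)
    distrib : ∀ x y z → (x - y) * z ≡ x * z - y * z
    distrib = solve 3 (λ x y z → (x :- y) :* z := x :* z :- y :* z) refl
    cancel : ∀ x y → x + y - y ≡ x
    cancel = solve 2 (λ x y → x :+ y :- y := x) refl
    absorption : (ℕ→ℚ m - ℕ→ℚ b) * X ≡ ℕ→ℚ (suc b) * Y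
    absorption = begin
      (ℕ→ℚ m - ℕ→ℚ b) * X                     ≡⟨ distrib (ℕ→ℚ m) (ℕ→ℚ b) X ⟩
      ℕ→ℚ m * X - ℕ→ℚ b * X                   ≡⟨ cong (_- ℕ→ℚ b * X) (ℕ→ℚ-C-absorption m b) ⟩
      ℕ→ℚ (suc b) * Y + ℕ→ℚ b * X - ℕ→ℚ b * X ≡⟨ cancel (ℕ→ℚ (suc b) * Y) (ℕ→ℚ b * X) ⟩
      ℕ→ℚ (suc b) * Y                         ∎

  -- Polynomials in a natural variable

  module Basis (φ : ℕ → ℕ → ℚ) (φ-0 : ∀ m → φ m 0 ≡ 1ℚ) where

    combination : ℕ → (ℕ → ℚ) → ℕ → ℚ
    combination e p m = sumTo e (λ b → p b * φ m b)

    Represents : ℕ → (ℕ → ℚ) → (ℕ → ℚ) → Set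
    Represents e p g = ∀ m → g m ≡ combination e p m

    record Poly≤ (e : ℕ) (g : ℕ → ℚ) : Set where
      constructor poly≤
      field
        coeff      : ℕ → ℚ
        represents : Represents e coeff g

    record Leading (e : ℕ) (τ : ℚ) (g : ℕ → ℚ) : Set where
      constructor leading
      field
        coeff      : ℕ → ℚ
        represents : Represents e coeff g
        top        : coeff e ≡ τ

    Leading⇒Poly≤ : ∀ {e τ g} → Leading e τ g → Poly≤ e g
    Leading⇒Poly≤ (leading p rep _) = poly≤ p rep

    Poly≤-cong : ∀ {e g h} → (∀ m → g m ≡ h m) → Poly≤ e g → Poly≤ e h
    Poly≤-cong g≡h (poly≤ p rep) = poly≤ p λ m → trans (sym (g≡h m)) (rep m)

    Leading-cong : ∀ {e τ g h} → (∀ m → g m ≡ h m) → Leading e τ g → Leading e τ h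
    Leading-cong g≡h (leading p rep top) = leading p (λ m → trans (sym (g≡h m)) (rep m)) top

    Leading-top : ∀ {e τ τ′ g} → τ ≡ τ′ → Leading e τ g → Leading e τ′ g
    Leading-top τ≡τ′ (leading p rep top) = leading p rep (trans top τ≡τ′)

    Leading-const : ∀ c → Leading 0 c (λ _ → c)
    Leading-const c = leading (λ _ → c) (λ m → sym (trans (cong (c *_) (φ-0 m)) (*-identityʳ c))) refl

    Poly≤-const : ∀ c → Poly≤ 0 (λ _ → c)
    Poly≤-const c = Leading⇒Poly≤ (Leading-const c)

    Poly≤-zero : ∀ e {g} → (∀ m → g m ≡ 0ℚ) → Poly≤ e g
    Poly≤-zero e g≡0 = poly≤ (λ _ → 0ℚ) λ m → trans (g≡0 m) (sym (sumTo-zero e (λ b _ → *-zeroˡ (φ m b))))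

    Leading-+ : ∀ {e τ τ′ g h} → Leading e τ g → Leading e τ′ h → Leading e (τ + τ′) (λ m → g m + h m)
    Leading-+ {e} (leading p rep-g top-g) (leading p′ rep-h top-h) = leading (λ b → p b + p′ b) (λ m → begin
      _                                                    ≡⟨ cong₂ _+_ (rep-g m) (rep-h m) ⟩
      combination e p m + combination e p′ m               ≡⟨ sumTo-+ e _ _ ⟨
      sumTo e (λ b → p b * φ m b + p′ b * φ m b)           ≡⟨ sumTo-cong e (λ b → *-distribʳ-+ (φ m b) (p b) (p′ b)) ⟨
      combination e (λ b → p b + p′ b) m                   ∎) (cong₂ _+_ top-g top-h)
      where open ≡-Reasoning

    Poly≤-+ : ∀ {e g h} → Poly≤ e g → Poly≤ e h → Poly≤ e (λ m → g m + h m)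
    Poly≤-+ (poly≤ p rep-g) (poly≤ p′ rep-h) = Leading⇒Poly≤ (Leading-+ (leading p rep-g refl) (leading p′ rep-h refl))

    Leading-scale : ∀ {e τ g} c → Leading e τ g → Leading e (c * τ) (λ m → c * g m)
    Leading-scale {e} c (leading p rep top) = leading (λ b → c * p b) (λ m → begin
      c * _                                       ≡⟨ cong (c *_) (rep m) ⟩
      c * combination e p m                       ≡⟨ *-distribˡ-sumTo e c _ ⟩
      sumTo e (λ b → c * (p b * φ m b))           ≡⟨ sumTo-cong e (λ b → *-assoc c (p b) (φ m b)) ⟨
      combination e (λ b → c * p b) m             ∎) (cong (c *_) top)
      where open ≡-Reasoning

    Poly≤-scale : ∀ {e g} c → Poly≤ e g → Poly≤ e (λ m → c * g m)
    Poly≤-scale c (poly≤ p rep) = Leading⇒Poly≤ (Leading-scale c (leading p rep refl))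

    Poly≤-sum : ∀ {e} n {g : ℕ → ℕ → ℚ} → (∀ j → j ≤ n → Poly≤ e (g j)) →
                Poly≤ e (λ m → sumTo n (λ j → g j m))
    Poly≤-sum zero    poly = poly 0 z≤n
    Poly≤-sum (suc n) poly = Poly≤-+ (Poly≤-sum n (λ j j≤n → poly j (ℕ.m≤n⇒m≤1+n j≤n))) (poly (suc n) ℕ.≤-refl)

    truncate : ℕ → (ℕ → ℚ) → ℕ → ℚ
    truncate e p b with b ℕ.≤? e
    ... | yes _ = p b
    ... | no  _ = 0ℚ

    truncate-≤ : ∀ {e b} p → b ≤ e → truncate e p b ≡ p b
    truncate-≤ {e} {b} p b≤e with b ℕ.≤? e
    ... | yes _   = refl
    ... | no  b≰e = contradiction b≤e b≰e

    truncate-> : ∀ {e b} p → e < b → truncate e p b ≡ 0ℚ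
    truncate-> {e} {b} p e<b with b ℕ.≤? e
    ... | yes b≤e = contradiction b≤e (ℕ.<⇒≱ e<b)
    ... | no  _   = refl

    truncate-represents : ∀ {e e′ g} p → e ≤ e′ → Represents e p g → Represents e′ (truncate e p) g
    truncate-represents {e} {e′} p e≤e′ rep m = begin
      _                                          ≡⟨ rep m ⟩
      combination e p m                          ≡⟨ sumTo-cong≤ e (λ b b≤e → cong (_* φ m b) (truncate-≤ p b≤e)) ⟨
      combination e (truncate e p) m
        ≡⟨ sumTo-extend {e} {e′} e≤e′ (λ b e<b _ → trans (cong (_* φ m b) (truncate-> p e<b)) (*-zeroˡ (φ m b))) ⟨
      combination e′ (truncate e p) m            ∎
      where open ≡-Reasoning

    Poly≤-mono : ∀ {e e′ g} → e ≤ e′ → Poly≤ e g → Poly≤ e′ g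
    Poly≤-mono e≤e′ (poly≤ p rep) = poly≤ (truncate _ p) (truncate-represents p e≤e′ rep)

    Poly≤⇒Leading-suc : ∀ {e g} → Poly≤ e g → Leading (suc e) 0ℚ g
    Poly≤⇒Leading-suc {e} (poly≤ p rep) = leading (truncate e p) (truncate-represents p (ℕ.n≤1+n e) rep) (truncate-> p (ℕ.n<1+n e))

    Poly≤-basis : ∀ b → Poly≤ b (λ m → φ m b)
    Poly≤-basis b = poly≤ (δ b) λ m → sym (sumTo-δ b (φ m))

  module Newton   = Basis (λ m b → ℕ→ℚ (m C b)) (λ _ → refl)
  module Monomial = Basis (λ m b → ℕ→ℚ m ^ℚ b) (λ _ → refl)

  open Newton using (poly≤)

  Newton-*id-basis : ∀ b → Newton.Poly≤ (suc b) (λ m → ℕ→ℚ m * ℕ→ℚ (m C b))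
  Newton-*id-basis b =
    Newton.Poly≤-cong (λ m → sym (ℕ→ℚ-C-absorption m b))
      (Newton.Poly≤-+ (Newton.Poly≤-scale (ℕ→ℚ (suc b)) (Newton.Poly≤-basis (suc b)))
                      (Newton.Poly≤-mono (ℕ.n≤1+n b) (Newton.Poly≤-scale (ℕ→ℚ b) (Newton.Poly≤-basis b))))

  Newton-*id : ∀ {e g} → Newton.Poly≤ e g → Newton.Poly≤ (suc e) (λ m → ℕ→ℚ m * g m)
  Newton-*id {e} {g} (poly≤ p rep) =
    Newton.Poly≤-cong expand
      (Newton.Poly≤-sum e (λ b b≤e → Newton.Poly≤-mono (s≤s b≤e) (Newton.Poly≤-scale (p b) (Newton-*id-basis b))))
    where
    expand : ∀ m → sumTo e (λ b → p b * (ℕ→ℚ m * ℕ→ℚ (m C b))) ≡ ℕ→ℚ m * g m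
    expand m = begin
      sumTo e (λ b → p b * (ℕ→ℚ m * ℕ→ℚ (m C b)))     ≡⟨ sumTo-cong e (λ b → ℚ*.x∙yz≈y∙xz (p b) (ℕ→ℚ m) _) ⟩
      sumTo e (λ b → ℕ→ℚ m * (p b * ℕ→ℚ (m C b)))     ≡⟨ *-distribˡ-sumTo e (ℕ→ℚ m) _ ⟨
      ℕ→ℚ m * Newton.combination e p m                ≡⟨ cong (ℕ→ℚ m *_) (rep m) ⟨
      ℕ→ℚ m * g m                                     ∎
      where open ≡-Reasoning

  linear-distrib : ∀ α β x y → α * (x * y) + β * y ≡ (α * x + β) * y
  linear-distrib = solve 4 (λ α β x y → α :* (x :* y) :+ β :* y := (α :* x :+ β) :* y) refl
    where open +-*-Solver

  Newton-*linear : ∀ {e g} α β → Newton.Poly≤ e g → Newton.Poly≤ (suc e) (λ m → (α * ℕ→ℚ m + β) * g m)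
  Newton-*linear {e} {g} α β P =
    Newton.Poly≤-cong (λ m → linear-distrib α β (ℕ→ℚ m) (g m))
      (Newton.Poly≤-+ (Newton.Poly≤-scale α (Newton-*id P)) (Newton.Poly≤-mono (ℕ.n≤1+n e) (Newton.Poly≤-scale β P)))

  Newton-*C : ∀ {e g} b → Newton.Poly≤ e g → Newton.Poly≤ (b ℕ.+ e) (λ m → ℕ→ℚ (m C b) * g m)
  Newton-*C {g = g} zero    P = Newton.Poly≤-cong (λ m → sym (*-identityˡ (g m))) P
  Newton-*C {g = g} (suc b) P =
    Newton.Poly≤-cong pascal (Newton.Poly≤-scale (1/ℕ (suc b)) (Newton-*linear 1ℚ (- ℕ→ℚ b) (Newton-*C b P)))
    where
    open +-*-Solver
    regroup : ∀ r x y c z → r * ((1ℚ * x + - y) * (c * z)) ≡ r * ((x - y) * c) * z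
    regroup = solve 5 (λ r x y c z → r :* ((con 1ℚ :* x :+ :- y) :* (c :* z)) := r :* ((x :- y) :* c) :* z) refl
    pascal : ∀ m → 1/ℕ (suc b) * ((1ℚ * ℕ→ℚ m + - ℕ→ℚ b) * (ℕ→ℚ (m C b) * g m)) ≡ ℕ→ℚ (m C suc b) * g m
    pascal m = trans (regroup (1/ℕ (suc b)) (ℕ→ℚ m) (ℕ→ℚ b) (ℕ→ℚ (m C b)) (g m)) (cong (_* g m) (sym (C-suc m b)))

  Newton-* : ∀ {e₁ e₂ g h} → Newton.Poly≤ e₁ g → Newton.Poly≤ e₂ h → Newton.Poly≤ (e₁ ℕ.+ e₂) (λ m → g m * h m)
  Newton-* {e₁} {e₂} {g} {h} (poly≤ p rep) Q =
    Newton.Poly≤-cong expand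
      (Newton.Poly≤-sum e₁ (λ b b≤e₁ → Newton.Poly≤-mono (ℕ.+-monoˡ-≤ e₂ b≤e₁) (Newton.Poly≤-scale (p b) (Newton-*C b Q))))
    where
    expand : ∀ m → sumTo e₁ (λ b → p b * (ℕ→ℚ (m C b) * h m)) ≡ g m * h m
    expand m = begin
      sumTo e₁ (λ b → p b * (ℕ→ℚ (m C b) * h m))    ≡⟨ sumTo-cong e₁ (λ b → *-assoc (p b) _ (h m)) ⟨
      sumTo e₁ (λ b → p b * ℕ→ℚ (m C b) * h m)      ≡⟨ *-distribʳ-sumTo e₁ (h m) _ ⟨
      Newton.combination e₁ p m * h m               ≡⟨ cong (_* h m) (rep m) ⟨
      g m * h m                                     ∎
      where open ≡-Reasoning

  C-affine-suc : ∀ α c b m → 1/ℕ (suc b) * ((ℕ→ℚ α * ℕ→ℚ m + (ℕ→ℚ c - ℕ→ℚ b)) * ℕ→ℚ ((α ℕ.* m ℕ.+ c) C b))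
                           ≡ ℕ→ℚ ((α ℕ.* m ℕ.+ c) C suc b)
  C-affine-suc α c b m = begin
    1/ℕ (suc b) * ((ℕ→ℚ α * ℕ→ℚ m + (ℕ→ℚ c - ℕ→ℚ b)) * ℕ→ℚ (x C b))
      ≡⟨ cong (λ t → 1/ℕ (suc b) * (t * ℕ→ℚ (x C b))) (+-assoc (ℕ→ℚ α * ℕ→ℚ m) (ℕ→ℚ c) (- ℕ→ℚ b)) ⟨
    1/ℕ (suc b) * ((ℕ→ℚ α * ℕ→ℚ m + ℕ→ℚ c - ℕ→ℚ b) * ℕ→ℚ (x C b))
      ≡⟨ cong (λ t → 1/ℕ (suc b) * ((t - ℕ→ℚ b) * ℕ→ℚ (x C b))) (ℕ→ℚ-affine α c m) ⟨
    1/ℕ (suc b) * ((ℕ→ℚ x - ℕ→ℚ b) * ℕ→ℚ (x C b))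
      ≡⟨ C-suc x b ⟨
    ℕ→ℚ (x C suc b) ∎
    where
    open ≡-Reasoning
    x : ℕ
    x = α ℕ.* m ℕ.+ c

  Newton-C-affine : ∀ α c b → Newton.Poly≤ b (λ m → ℕ→ℚ ((α ℕ.* m ℕ.+ c) C b))
  Newton-C-affine α c zero    = Newton.Poly≤-const 1ℚ
  Newton-C-affine α c (suc b) =
    Newton.Poly≤-cong (C-affine-suc α c b)
      (Newton.Poly≤-scale (1/ℕ (suc b)) (Newton-*linear (ℕ→ℚ α) (ℕ→ℚ c - ℕ→ℚ b) (Newton-C-affine α c b)))

  Newton-affine-^ : ∀ α c t → Newton.Poly≤ t (λ m → ℕ→ℚ (α ℕ.* m ℕ.+ c) ^ℚ t)
  Newton-affine-^ α c zero    = Newton.Poly≤-const 1ℚ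
  Newton-affine-^ α c (suc t) =
    Newton.Poly≤-cong (λ m → cong (_* ℕ→ℚ (α ℕ.* m ℕ.+ c) ^ℚ t) (sym (ℕ→ℚ-affine α c m)))
      (Newton-*linear (ℕ→ℚ α) (ℕ→ℚ c) (Newton-affine-^ α c t))

  Newton-∘affine : ∀ {e g} α c → Newton.Poly≤ e g → Newton.Poly≤ e (λ m → g (α ℕ.* m ℕ.+ c))
  Newton-∘affine {e} α c (poly≤ p rep) =
    Newton.Poly≤-cong (λ m → sym (rep (α ℕ.* m ℕ.+ c)))
      (Newton.Poly≤-sum e (λ b b≤e → Newton.Poly≤-mono b≤e (Newton.Poly≤-scale (p b) (Newton-C-affine α c b))))

  Newton-shift : ∀ {e g} → Newton.Poly≤ e g → Newton.Poly≤ e (λ k → g (suc k))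
  Newton-shift {g = g} P =
    Newton.Poly≤-cong (λ k → cong g (trans (ℕ.+-comm (1 ℕ.* k) 1) (cong suc (ℕ.*-identityˡ k)))) (Newton-∘affine 1 1 P)

  Newton-telescope : ∀ {e} {f u : ℕ → ℚ} → (∀ k → f (suc k) ≡ f k + u k) →
                     Newton.Poly≤ e u → Newton.Poly≤ (suc e) f
  Newton-telescope {e} {f} {u} step (poly≤ p rep) = poly≤ coeff λ k → trans (partial-sums k) (sym (sumTo-suc e _))
    where
    coeff : ℕ → ℚ
    coeff zero    = f 0
    coeff (suc b) = p b
    partial-sums : ∀ k → f k ≡ f 0 * 1ℚ + sumTo e (λ b → p b * ℕ→ℚ (k C suc b))
    partial-sums zero    = sym (trans (cong₂ _+_ (*-identityʳ (f 0)) (sumTo-zero e (λ b _ → *-zeroʳ (p b))))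
                                      (+-identityʳ (f 0)))
    partial-sums (suc k) = begin
      f (suc k)
        ≡⟨ step k ⟩
      f k + u k
        ≡⟨ cong₂ _+_ (partial-sums k) (rep k) ⟩
      f 0 * 1ℚ + sumTo e (λ b → p b * ℕ→ℚ (k C suc b)) + sumTo e (λ b → p b * ℕ→ℚ (k C b))
        ≡⟨ +-assoc (f 0 * 1ℚ) _ _ ⟩
      f 0 * 1ℚ + (sumTo e (λ b → p b * ℕ→ℚ (k C suc b)) + sumTo e (λ b → p b * ℕ→ℚ (k C b)))
        ≡⟨ cong (f 0 * 1ℚ +_) (trans (sym (sumTo-+ e _ _)) (sumTo-cong e pascal)) ⟩
      f 0 * 1ℚ + sumTo e (λ b → p b * ℕ→ℚ (suc k C suc b)) ∎
      where
      open ≡-Reasoning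
      pascal : ∀ b → p b * ℕ→ℚ (k C suc b) + p b * ℕ→ℚ (k C b) ≡ p b * ℕ→ℚ (suc k C suc b)
      pascal b = begin
        p b * ℕ→ℚ (k C suc b) + p b * ℕ→ℚ (k C b)   ≡⟨ *-distribˡ-+ (p b) (ℕ→ℚ (k C suc b)) (ℕ→ℚ (k C b)) ⟨
        p b * (ℕ→ℚ (k C suc b) + ℕ→ℚ (k C b))       ≡⟨ cong (p b *_) (+-comm (ℕ→ℚ (k C suc b)) (ℕ→ℚ (k C b))) ⟩
        p b * (ℕ→ℚ (k C b) + ℕ→ℚ (k C suc b))       ≡⟨ cong (p b *_) (ℕ→ℚ-homo-+ (k C b) (k C suc b)) ⟨
        p b * ℕ→ℚ (k C b ℕ.+ k C suc b)             ≡⟨ cong (λ t → p b * ℕ→ℚ t) (nCk+nC[k+1]≡[n+1]C[k+1] k b) ⟩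
        p b * ℕ→ℚ (suc k C suc b)                   ∎

  Monomial-*id : ∀ {e τ g} → Monomial.Leading e τ g → Monomial.Leading (suc e) τ (λ m → ℕ→ℚ m * g m)
  Monomial-*id {e} {g = g} (Monomial.leading p rep top) = Monomial.leading shifted expand top
    where
    shifted : ℕ → ℚ
    shifted zero    = 0ℚ
    shifted (suc b) = p b
    expand : ∀ m → ℕ→ℚ m * g m ≡ Monomial.combination (suc e) shifted m
    expand m = begin
      ℕ→ℚ m * g m                                        ≡⟨ cong (ℕ→ℚ m *_) (rep m) ⟩
      ℕ→ℚ m * Monomial.combination e p m                 ≡⟨ *-distribˡ-sumTo e (ℕ→ℚ m) _ ⟩
      sumTo e (λ b → ℕ→ℚ m * (p b * ℕ→ℚ m ^ℚ b))         ≡⟨ sumTo-cong e (λ b → ℚ*.x∙yz≈y∙xz (ℕ→ℚ m) (p b) _) ⟩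
      S                                                  ≡⟨ +-identityˡ S ⟨
      0ℚ + S                                             ≡⟨ cong (_+ S) (*-zeroˡ 1ℚ) ⟨
      0ℚ * 1ℚ + S                                        ≡⟨ sumTo-suc e (λ b → shifted b * ℕ→ℚ m ^ℚ b) ⟨
      Monomial.combination (suc e) shifted m             ∎
      where
      open ≡-Reasoning
      S : ℚ
      S = sumTo e (λ b → p b * ℕ→ℚ m ^ℚ suc b)

  Monomial-*linear : ∀ {e τ g} α β → Monomial.Leading e τ g →
                     Monomial.Leading (suc e) (α * τ) (λ m → (α * ℕ→ℚ m + β) * g m)
  Monomial-*linear {e} {τ} {g} α β L =
    Monomial.Leading-cong (λ m → linear-distrib α β (ℕ→ℚ m) (g m))
      (Monomial.Leading-top (+-identityʳ (α * τ))
        (Monomial.Leading-+ (Monomial.Leading-scale α (Monomial-*id L))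
                            (Monomial.Poly≤⇒Leading-suc (Monomial.Poly≤-scale β (Monomial.Leading⇒Poly≤ L)))))

  Monomial-C-affine : ∀ α c b → Monomial.Leading b (ℕ→ℚ α ^ℚ b * 1/ℕ (b !) {{b ℕ.!≢0}})
                                                    (λ m → ℕ→ℚ ((α ℕ.* m ℕ.+ c) C b))
  Monomial-C-affine α c zero    = Monomial.Leading-const 1ℚ
  Monomial-C-affine α c (suc b) =
    Monomial.Leading-cong (C-affine-suc α c b)
      (Monomial.Leading-top top
        (Monomial.Leading-scale (1/ℕ (suc b)) (Monomial-*linear (ℕ→ℚ α) (ℕ→ℚ c - ℕ→ℚ b) (Monomial-C-affine α c b))))
    where
    instance _ = b ℕ.!≢0
    top : 1/ℕ (suc b) * (ℕ→ℚ α * (ℕ→ℚ α ^ℚ b * 1/ℕ (b !))) ≡ ℕ→ℚ α ^ℚ suc b * 1/ℕ (suc b !) {{suc b ℕ.!≢0}}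
    top = begin
      1/ℕ (suc b) * (ℕ→ℚ α * (ℕ→ℚ α ^ℚ b * 1/ℕ (b !)))   ≡⟨ ℚ*.x∙yz≈y∙xz (1/ℕ (suc b)) (ℕ→ℚ α) _ ⟩
      ℕ→ℚ α * (1/ℕ (suc b) * (ℕ→ℚ α ^ℚ b * 1/ℕ (b !)))
        ≡⟨ cong (ℕ→ℚ α *_) (ℚ*.x∙yz≈y∙xz (1/ℕ (suc b)) (ℕ→ℚ α ^ℚ b) (1/ℕ (b !))) ⟩
      ℕ→ℚ α * (ℕ→ℚ α ^ℚ b * (1/ℕ (suc b) * 1/ℕ (b !)))
        ≡⟨ cong (λ t → ℕ→ℚ α * (ℕ→ℚ α ^ℚ b * t)) (1/ℕ-homo-* (suc b) (b !)) ⟨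
      ℕ→ℚ α * (ℕ→ℚ α ^ℚ b * 1/ℕ (suc b !) {{suc b ℕ.!≢0}})   ≡⟨ *-assoc (ℕ→ℚ α) (ℕ→ℚ α ^ℚ b) _ ⟨
      ℕ→ℚ α ^ℚ suc b * 1/ℕ (suc b !) {{suc b ℕ.!≢0}}    ∎
      where open ≡-Reasoning

  Newton⇒Monomial : ∀ {e g} → Newton.Poly≤ e g → Monomial.Poly≤ e g
  Newton⇒Monomial {e} (poly≤ p rep) =
    Monomial.Poly≤-cong (λ m → sym (rep m))
      (Monomial.Poly≤-sum e (λ b b≤e → Monomial.Poly≤-mono b≤e (Monomial.Poly≤-scale (p b)
        (Monomial.Poly≤-cong (λ m → cong (λ x → ℕ→ℚ (x C b)) (trans (ℕ.+-identityʳ (1 ℕ.* m)) (ℕ.*-identityˡ m)))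
          (Monomial.Leading⇒Poly≤ (Monomial-C-affine 1 0 b))))))

  IsPolyOfDegree-intro : ∀ D {f : ℕ → ℚ → ℚ} (g : ℕ → ℕ → ℚ) →
    (∀ m l → f m l ≡ sumTo D (λ a → l ^ℚ a * g a m)) →
    (∀ a → Monomial.Poly≤ (D ℕ.∸ a) (g a)) →
    ∀ {a₀ τ} → a₀ ≤ D → Monomial.Leading (D ℕ.∸ a₀) τ (g a₀) → τ ≢ 0ℚ →
    IsPolyOfDegree (ℤ.+ D) f
  IsPolyOfDegree-intro D {f} g expand poly {a₀} {τ} a₀≤D lead τ≢0 =
    table , represents , a₀ , a₀≤D , λ top≡0 → τ≢0 (trans (sym (table-top (a₀ ℕ.≟ a₀))) top≡0)
    where
    choose : ∀ a → Dec (a ≡ a₀) → Monomial.Poly≤ (D ℕ.∸ a) (g a)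
    choose a (yes refl) = Monomial.Leading⇒Poly≤ lead
    choose a (no _)     = poly a
    table : ℕ → ℕ → ℚ
    table a = Monomial.Poly≤.coeff (choose a (a ℕ.≟ a₀))
    table-top : ∀ a₀≟a₀ → Monomial.Poly≤.coeff (choose a₀ a₀≟a₀) (D ℕ.∸ a₀) ≡ τ
    table-top (yes refl) = Monomial.Leading.top lead
    table-top (no a₀≢a₀) = contradiction refl a₀≢a₀
    represents : ∀ m l → f m l ≡ evalPoly2 D table l (ℕ→ℚ m)
    represents m l = begin
      f m l
        ≡⟨ expand m l ⟩
      sumTo D (λ a → l ^ℚ a * g a m)
        ≡⟨ sumTo-cong D (λ a → cong (l ^ℚ a *_) (Monomial.Poly≤.represents (choose a (a ℕ.≟ a₀)) m)) ⟩
      sumTo D (λ a → l ^ℚ a * sumTo (D ℕ.∸ a) (λ b → table a b * ℕ→ℚ m ^ℚ b))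
        ≡⟨ sumTo-cong D (λ a → trans (*-distribˡ-sumTo (D ℕ.∸ a) (l ^ℚ a) _)
                                     (sumTo-cong (D ℕ.∸ a) (λ b → ℚ*.x∙yz≈yx∙z (l ^ℚ a) (table a b) (ℕ→ℚ m ^ℚ b)))) ⟩
      evalPoly2 D table l (ℕ→ℚ m) ∎
      where open ≡-Reasoning

  -- Polynomials in x listed from the leading coefficient, and the powers of P

  descending : ℕ → (ℕ → ℚ) → ℚ → ℚ
  descending n c x = sumTo n (λ t → c t * x ^ℚ (n ℕ.∸ t))

  descending-cong≤ : ∀ n {c c′ : ℕ → ℚ} x → (∀ t → t ≤ n → c t ≡ c′ t) → descending n c x ≡ descending n c′ x
  descending-cong≤ n x c≡c′ = sumTo-cong≤ n (λ t t≤n → cong (_* x ^ℚ (n ℕ.∸ t)) (c≡c′ t t≤n))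

  convolution : (ℕ → ℚ) → (ℕ → ℚ) → ℕ → ℚ
  convolution a b u = sumTo u (λ j → a j * b (u ℕ.∸ j))

  sumTo-antidiagonal : ∀ n (F : ℕ → ℕ → ℚ) →
    sumTo n (λ u → sumTo u (λ i → F i (u ℕ.∸ i))) ≡ sumTo n (λ i → sumTo (n ℕ.∸ i) (F i))
  sumTo-antidiagonal zero    F = refl
  sumTo-antidiagonal (suc n) F = begin
      sumTo n (λ u → sumTo u (λ i → F i (u ℕ.∸ i))) + sumTo (suc n) (λ i → F i (suc n ℕ.∸ i))
    ≡⟨ cong (_+ sumTo (suc n) (λ i → F i (suc n ℕ.∸ i))) (sumTo-antidiagonal n F) ⟩
      R + (sumTo n (λ i → F i (suc n ℕ.∸ i)) + F (suc n) (n ℕ.∸ n))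
    ≡⟨ +-assoc R _ _ ⟨
      R + sumTo n (λ i → F i (suc n ℕ.∸ i)) + F (suc n) (n ℕ.∸ n)
    ≡⟨ cong₂ _+_ (sumTo-+ n _ _) (cong (F (suc n)) (sym (ℕ.n∸n≡0 n))) ⟨
      sumTo n (λ i → sumTo (n ℕ.∸ i) (F i) + F i (suc n ℕ.∸ i)) + F (suc n) 0
    ≡⟨ cong (_+ F (suc n) 0) (sumTo-cong≤ n last-term) ⟨
      sumTo n (λ i → sumTo (suc n ℕ.∸ i) (F i)) + F (suc n) 0
    ≡⟨ cong (λ k → sumTo n (λ i → sumTo (suc n ℕ.∸ i) (F i)) + sumTo k (F (suc n))) (ℕ.n∸n≡0 n) ⟨
      sumTo (suc n) (λ i → sumTo (suc n ℕ.∸ i) (F i))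
    ∎
    where
    open ≡-Reasoning
    R : ℚ
    R = sumTo n (λ i → sumTo (n ℕ.∸ i) (F i))
    last-term : ∀ i → i ≤ n → sumTo (suc n ℕ.∸ i) (F i) ≡ sumTo (n ℕ.∸ i) (F i) + F i (suc n ℕ.∸ i)
    last-term i i≤n rewrite ℕ.+-∸-assoc 1 i≤n = refl

  ∸-+-∸ : ∀ {m n i j} → i ≤ m → j ≤ n → (m ℕ.∸ i) ℕ.+ (n ℕ.∸ j) ≡ (m ℕ.+ n) ℕ.∸ (i ℕ.+ j)
  ∸-+-∸ {m} {n} {i} {j} i≤m j≤n = begin
    (m ℕ.∸ i) ℕ.+ (n ℕ.∸ j)     ≡⟨ ℕ.+-∸-assoc (m ℕ.∸ i) j≤n ⟨
    (m ℕ.∸ i) ℕ.+ n ℕ.∸ j       ≡⟨ cong (ℕ._∸ j) (ℕ.+-∸-comm n i≤m) ⟨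
    (m ℕ.+ n) ℕ.∸ i ℕ.∸ j       ≡⟨ ℕ.∸-+-assoc (m ℕ.+ n) i j ⟩
    (m ℕ.+ n) ℕ.∸ (i ℕ.+ j)     ∎
    where open ≡-Reasoning

  sumTo-rectangle : ∀ m n (F : ℕ → ℕ → ℚ) → (∀ i j → m < i → F i j ≡ 0ℚ) → (∀ i j → n < j → F i j ≡ 0ℚ) →
    sumTo m (λ i → sumTo n (F i)) ≡ sumTo (m ℕ.+ n) (λ u → sumTo u (λ i → F i (u ℕ.∸ i)))
  sumTo-rectangle m n F F≡0ˡ F≡0ʳ = begin
    sumTo m (λ i → sumTo n (F i))
      ≡⟨ sumTo-cong≤ m (λ i i≤m → sumTo-extend (n≤M∸i i≤m) (λ j n<j _ → F≡0ʳ i j n<j)) ⟨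
    sumTo m (λ i → sumTo (M ℕ.∸ i) (F i))
      ≡⟨ sumTo-extend (ℕ.m≤m+n m n) (λ i m<i _ → sumTo-zero (M ℕ.∸ i) (λ j _ → F≡0ˡ i j m<i)) ⟨
    sumTo M (λ i → sumTo (M ℕ.∸ i) (F i))
      ≡⟨ sumTo-antidiagonal M F ⟨
    sumTo M (λ u → sumTo u (λ i → F i (u ℕ.∸ i))) ∎
    where
    open ≡-Reasoning
    M : ℕ
    M = m ℕ.+ n
    n≤M∸i : ∀ {i} → i ≤ m → n ≤ M ℕ.∸ i
    n≤M∸i {i} i≤m = subst (n ≤_) (sym (ℕ.+-∸-comm n i≤m)) (ℕ.m≤n+m n (m ℕ.∸ i))

  descending-* : ∀ m n (a b : ℕ → ℚ) x → (∀ t → m < t → a t ≡ 0ℚ) → (∀ t → n < t → b t ≡ 0ℚ) →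
                 descending m a x * descending n b x ≡ descending (m ℕ.+ n) (convolution a b) x
  descending-* m n a b x a≡0 b≡0 = begin
      descending m a x * descending n b x
    ≡⟨ *-distribʳ-sumTo m _ _ ⟩
      sumTo m (λ i → a i * x ^ℚ (m ℕ.∸ i) * descending n b x)
    ≡⟨ sumTo-cong m (λ i → *-distribˡ-sumTo n (a i * x ^ℚ (m ℕ.∸ i)) _) ⟩
      sumTo m (λ i → sumTo n (λ j → a i * x ^ℚ (m ℕ.∸ i) * (b j * x ^ℚ (n ℕ.∸ j))))
    ≡⟨ sumTo-cong≤ m (λ i i≤m → sumTo-cong≤ n (λ j j≤n → collect i j i≤m j≤n)) ⟩
      sumTo m (λ i → sumTo n (F i))
    ≡⟨ sumTo-rectangle m n F F-vanishesˡ F-vanishesʳ ⟩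
      sumTo M (λ u → sumTo u (λ i → F i (u ℕ.∸ i)))
    ≡⟨ sumTo-cong M (λ u → sumTo-cong≤ u (λ i i≤u →
         cong (λ k → a i * b (u ℕ.∸ i) * x ^ℚ (M ℕ.∸ k)) (ℕ.m+[n∸m]≡n i≤u))) ⟩
      sumTo M (λ u → sumTo u (λ i → a i * b (u ℕ.∸ i) * x ^ℚ (M ℕ.∸ u)))
    ≡⟨ sumTo-cong M (λ u → *-distribʳ-sumTo u (x ^ℚ (M ℕ.∸ u)) _) ⟨
      descending M (convolution a b) x
    ∎
    where
    open ≡-Reasoning
    M : ℕ
    M = m ℕ.+ n
    F : ℕ → ℕ → ℚ
    F i j = a i * b j * x ^ℚ (M ℕ.∸ (i ℕ.+ j))
    collect : ∀ i j → i ≤ m → j ≤ n → a i * x ^ℚ (m ℕ.∸ i) * (b j * x ^ℚ (n ℕ.∸ j)) ≡ F i j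
    collect i j i≤m j≤n = begin
      a i * x ^ℚ (m ℕ.∸ i) * (b j * x ^ℚ (n ℕ.∸ j))     ≡⟨ ℚ*.interchange (a i) _ (b j) _ ⟩
      a i * b j * (x ^ℚ (m ℕ.∸ i) * x ^ℚ (n ℕ.∸ j))     ≡⟨ cong (a i * b j *_) (^ℚ-+ x (m ℕ.∸ i) (n ℕ.∸ j)) ⟨
      a i * b j * x ^ℚ ((m ℕ.∸ i) ℕ.+ (n ℕ.∸ j))        ≡⟨ cong (λ k → a i * b j * x ^ℚ k) (∸-+-∸ i≤m j≤n) ⟩
      F i j                                            ∎
    X : ℕ → ℕ → ℚ
    X i j = x ^ℚ (M ℕ.∸ (i ℕ.+ j))
    F-vanishesˡ : ∀ i j → m < i → F i j ≡ 0ℚ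
    F-vanishesˡ i j m<i = trans (cong (λ t → t * b j * X i j) (a≡0 i m<i))
                                (trans (cong (_* X i j) (*-zeroˡ (b j))) (*-zeroˡ (X i j)))
    F-vanishesʳ : ∀ i j → n < j → F i j ≡ 0ℚ
    F-vanishesʳ i j n<j = trans (cong (λ t → a i * t * X i j) (b≡0 j n<j))
                                (trans (cong (_* X i j) (*-zeroʳ (a i))) (*-zeroˡ (X i j)))

  linear-coeff : ℚ → ℕ → ℚ
  linear-coeff y zero          = 1ℚ
  linear-coeff y (suc zero)    = y
  linear-coeff y (suc (suc _)) = 0ℚ

  convolution-linear : ∀ y (c : ℕ → ℚ) u → convolution (linear-coeff y) c (suc u) ≡ c (suc u) + y * c u
  convolution-linear y c u = begin
    convolution (linear-coeff y) c (suc u)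
      ≡⟨ sumTo-suc u (λ j → linear-coeff y j * c (suc u ℕ.∸ j)) ⟩
    1ℚ * c (suc u) + sumTo u (λ j → linear-coeff y (suc j) * c (u ℕ.∸ j))
      ≡⟨ cong₂ _+_ (*-identityˡ (c (suc u))) (tail u) ⟩
    c (suc u) + y * c u ∎
    where
    open ≡-Reasoning
    tail : ∀ u → sumTo u (λ j → linear-coeff y (suc j) * c (u ℕ.∸ j)) ≡ y * c u
    tail zero    = refl
    tail (suc u) = begin
      sumTo (suc u) (λ j → linear-coeff y (suc j) * c (suc u ℕ.∸ j))
                                                        ≡⟨ sumTo-suc u (λ j → linear-coeff y (suc j) * c (suc u ℕ.∸ j)) ⟩
      y * c (suc u) + sumTo u (λ j → 0ℚ * c (u ℕ.∸ j))
                                                        ≡⟨ cong (y * c (suc u) +_) (sumTo-zero u (λ j _ → *-zeroˡ (c (u ℕ.∸ j)))) ⟩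
      y * c (suc u) + 0ℚ                                ≡⟨ +-identityʳ (y * c (suc u)) ⟩
      y * c (suc u)                                     ∎

  binomial-coeff : ℕ → ℚ → ℕ → ℚ
  binomial-coeff n y t = ℕ→ℚ (n C t) * y ^ℚ t

  binomial-coeff-suc : ∀ n y u → convolution (linear-coeff y) (binomial-coeff n y) u ≡ binomial-coeff (suc n) y u
  binomial-coeff-suc n y zero    = *-identityˡ (binomial-coeff n y 0)
  binomial-coeff-suc n y (suc u) = begin
    convolution (linear-coeff y) (binomial-coeff n y) (suc u)
      ≡⟨ convolution-linear y (binomial-coeff n y) u ⟩
    ℕ→ℚ (n C suc u) * (y * y ^ℚ u) + y * (ℕ→ℚ (n C u) * y ^ℚ u)
      ≡⟨ regroup (ℕ→ℚ (n C suc u)) (ℕ→ℚ (n C u)) y (y ^ℚ u) ⟩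
    (ℕ→ℚ (n C u) + ℕ→ℚ (n C suc u)) * (y * y ^ℚ u)
      ≡⟨ cong (_* (y * y ^ℚ u)) (ℕ→ℚ-homo-+ (n C u) (n C suc u)) ⟨
    ℕ→ℚ (n C u ℕ.+ n C suc u) * (y * y ^ℚ u)
      ≡⟨ cong (λ c → ℕ→ℚ c * (y * y ^ℚ u)) (nCk+nC[k+1]≡[n+1]C[k+1] n u) ⟩
    binomial-coeff (suc n) y (suc u) ∎
    where
    open ≡-Reasoning
    regroup : ∀ a b y z → a * (y * z) + y * (b * z) ≡ (b + a) * (y * z)
    regroup = solve 4 (λ a b y z → a :* (y :* z) :+ y :* (b :* z) := (b :+ a) :* (y :* z)) refl
      where open +-*-Solver

  binomial-descending : ∀ n x y → (x + y) ^ℚ n ≡ descending n (binomial-coeff n y) x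
  binomial-descending zero    x y = refl
  binomial-descending (suc n) x y = begin
    (x + y) * (x + y) ^ℚ n
      ≡⟨ cong₂ _*_ x+y-descending (binomial-descending n x y) ⟩
    descending 1 (linear-coeff y) x * descending n (binomial-coeff n y) x
      ≡⟨ descending-* 1 n (linear-coeff y) (binomial-coeff n y) x linear-vanishes binomial-vanishes ⟩
    descending (suc n) (convolution (linear-coeff y) (binomial-coeff n y)) x
      ≡⟨ descending-cong≤ (suc n) x (λ u _ → binomial-coeff-suc n y u) ⟩
    descending (suc n) (binomial-coeff (suc n) y) x ∎
    where
    open ≡-Reasoning
    x+y-descending : x + y ≡ descending 1 (linear-coeff y) x
    x+y-descending = solve 2 (λ x y → x :+ y := con 1ℚ :* (x :* con 1ℚ) :+ y :* con 1ℚ) refl x y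
      where open +-*-Solver
    linear-vanishes : ∀ t → 1 < t → linear-coeff y t ≡ 0ℚ
    linear-vanishes (suc zero)    (s≤s ())
    linear-vanishes (suc (suc t)) _ = refl
    binomial-vanishes : ∀ t → n < t → binomial-coeff n y t ≡ 0ℚ
    binomial-vanishes t n<t = trans (cong (λ c → ℕ→ℚ c * y ^ℚ t) (k>n⇒nCk≡0 n<t)) (*-zeroˡ (y ^ℚ t))

  P-coeff : ℕ → ℕ → ℚ
  P-coeff r t = ℕ→ℚ (suc r C suc t) * 1/ℕ (suc r)

  P-coeff-0 : ∀ r → P-coeff r 0 ≡ 1ℚ
  P-coeff-0 r = trans (cong (λ c → ℕ→ℚ c * 1/ℕ (suc r)) (nC1≡n (suc r))) (1/ℕ-inverseʳ (suc r))

  P-coeff-vanishes : ∀ r t → r < t → P-coeff r t ≡ 0ℚ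
  P-coeff-vanishes r t r<t = trans (cong (λ c → ℕ→ℚ c * 1/ℕ (suc r)) (k>n⇒nCk≡0 (s≤s r<t))) (*-zeroˡ (1/ℕ (suc r)))

  P-descending : ∀ r μ x → Pμ r μ x ≡ descending r (λ t → P-coeff r t * ℕ→ℚ μ ^ℚ t) x
  P-descending r zero x = sym (begin
    descending r (λ t → P-coeff r t * 0ℚ ^ℚ t) x
      ≡⟨ sumTo-extend {n = r} z≤n (λ t 0<t _ → higher t 0<t) ⟩
    P-coeff r 0 * 1ℚ * x ^ℚ r
      ≡⟨ cong (λ c → c * 1ℚ * x ^ℚ r) (P-coeff-0 r) ⟩
    1ℚ * 1ℚ * x ^ℚ r
      ≡⟨ *-identityˡ (x ^ℚ r) ⟩
    x ^ℚ r ∎)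
    where
    open ≡-Reasoning
    higher : ∀ t → 0 < t → P-coeff r t * 0ℚ ^ℚ t * x ^ℚ (r ℕ.∸ t) ≡ 0ℚ
    higher (suc t) _ = trans (cong (λ z → P-coeff r (suc t) * z * x ^ℚ (r ℕ.∸ suc t)) (*-zeroˡ (0ℚ ^ℚ t)))
                             (trans (cong (_* x ^ℚ (r ℕ.∸ suc t)) (*-zeroʳ (P-coeff r (suc t)))) (*-zeroˡ (x ^ℚ (r ℕ.∸ suc t))))
  P-descending r μ@(suc _) x = begin
    ((x + ℕ→ℚ μ) ^ℚ suc r - x ^ℚ suc r) * 1/ℕ (μ ℕ.* suc r)
      ≡⟨ cong (λ z → (z - x ^ℚ suc r) * 1/ℕ (μ ℕ.* suc r))
              (trans (binomial-descending (suc r) x (ℕ→ℚ μ)) (sumTo-suc r _)) ⟩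
    ((1ℚ * 1ℚ * x ^ℚ suc r + T) - x ^ℚ suc r) * 1/ℕ (μ ℕ.* suc r)
      ≡⟨ cong (_* 1/ℕ (μ ℕ.* suc r)) (cancel (x ^ℚ suc r) T) ⟩
    T * 1/ℕ (μ ℕ.* suc r)
      ≡⟨ cong (T *_) (1/ℕ-homo-* μ (suc r)) ⟩
    T * (1/ℕ μ * 1/ℕ (suc r))
      ≡⟨ *-distribʳ-sumTo r _ _ ⟩
    sumTo r (λ t → ℕ→ℚ (suc r C suc t) * ℕ→ℚ μ ^ℚ suc t * x ^ℚ (r ℕ.∸ t) * (1/ℕ μ * 1/ℕ (suc r)))
      ≡⟨ sumTo-cong r (λ t → divide (ℕ→ℚ (suc r C suc t)) (ℕ→ℚ μ ^ℚ t) (x ^ℚ (r ℕ.∸ t))) ⟩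
    descending r (λ t → P-coeff r t * ℕ→ℚ μ ^ℚ t) x ∎
    where
    open ≡-Reasoning
    open +-*-Solver
    T : ℚ
    T = sumTo r (λ t → ℕ→ℚ (suc r C suc t) * ℕ→ℚ μ ^ℚ suc t * x ^ℚ (r ℕ.∸ t))
    cancel : ∀ y T → (1ℚ * 1ℚ * y + T) - y ≡ T
    cancel = solve 2 (λ y T → (con 1ℚ :* con 1ℚ :* y :+ T) :- y := T) refl
    divide : ∀ c M X → c * (ℕ→ℚ μ * M) * X * (1/ℕ μ * 1/ℕ (suc r)) ≡ c * 1/ℕ (suc r) * M * X
    divide c M X = begin
      c * (ℕ→ℚ μ * M) * X * (1/ℕ μ * 1/ℕ (suc r))
        ≡⟨ solve 6 (λ c m M X u v → c :* (m :* M) :* X :* (u :* v) := (m :* u) :* (c :* v :* M :* X)) refl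
                 c (ℕ→ℚ μ) M X (1/ℕ μ) (1/ℕ (suc r)) ⟩
      (ℕ→ℚ μ * 1/ℕ μ) * (c * 1/ℕ (suc r) * M * X)
        ≡⟨ cong (_* (c * 1/ℕ (suc r) * M * X)) (1/ℕ-inverseʳ μ) ⟩
      1ℚ * (c * 1/ℕ (suc r) * M * X)
        ≡⟨ *-identityˡ _ ⟩
      c * 1/ℕ (suc r) * M * X ∎

  P^-coeff : ℕ → ℕ → ℕ → ℚ
  P^-coeff r zero    t = δ 0 t
  P^-coeff r (suc n) t = convolution (P-coeff r) (P^-coeff r n) t

  P^-coeff-vanishes : ∀ r n t → n ℕ.* r < t → P^-coeff r n t ≡ 0ℚ
  P^-coeff-vanishes r zero    t 0<t = δ-≢ (ℕ.<⇒≢ 0<t)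
  P^-coeff-vanishes r (suc n) t r+nr<t = sumTo-zero t (λ j _ → term j)
    where
    term : ∀ j → P-coeff r j * P^-coeff r n (t ℕ.∸ j) ≡ 0ℚ
    term j with j ℕ.≤? r
    ... | yes j≤r = trans (cong (P-coeff r j *_) (P^-coeff-vanishes r n (t ℕ.∸ j) nr<t∸j)) (*-zeroʳ (P-coeff r j))
      where
      nr<t∸j : n ℕ.* r < t ℕ.∸ j
      nr<t∸j = ℕ.m+n≤o⇒m≤o∸n (suc (n ℕ.* r))
                 (ℕ.≤-trans (ℕ.+-monoʳ-≤ (suc (n ℕ.* r)) j≤r) (subst (λ k → suc k ≤ t) (ℕ.+-comm r (n ℕ.* r)) r+nr<t))
    ... | no  j≰r = trans (cong (_* P^-coeff r n (t ℕ.∸ j)) (P-coeff-vanishes r j (ℕ.≰⇒> j≰r))) (*-zeroˡ (P^-coeff r n (t ℕ.∸ j)))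

  convolution-^ : ∀ (a b : ℕ → ℚ) z u →
    convolution (λ t → a t * z ^ℚ t) (λ t → b t * z ^ℚ t) u ≡ convolution a b u * z ^ℚ u
  convolution-^ a b z u = begin
    sumTo u (λ j → a j * z ^ℚ j * (b (u ℕ.∸ j) * z ^ℚ (u ℕ.∸ j)))
      ≡⟨ sumTo-cong≤ u (λ j j≤u → trans (ℚ*.interchange (a j) (z ^ℚ j) (b (u ℕ.∸ j)) (z ^ℚ (u ℕ.∸ j)))
                                         (cong (a j * b (u ℕ.∸ j) *_)
                                               (trans (sym (^ℚ-+ z j (u ℕ.∸ j))) (cong (z ^ℚ_) (ℕ.m+[n∸m]≡n j≤u))))) ⟩
    sumTo u (λ j → a j * b (u ℕ.∸ j) * z ^ℚ u)
      ≡⟨ *-distribʳ-sumTo u (z ^ℚ u) _ ⟨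
    convolution a b u * z ^ℚ u ∎
    where open ≡-Reasoning

  P^-descending : ∀ r μ n x → Pμ r μ x ^ℚ n ≡ descending (n ℕ.* r) (λ t → P^-coeff r n t * ℕ→ℚ μ ^ℚ t) x
  P^-descending r μ zero    x = sym (cong (λ c → c * 1ℚ * 1ℚ) (δ-refl 0))
  P^-descending r μ (suc n) x = begin
    Pμ r μ x * Pμ r μ x ^ℚ n
      ≡⟨ cong₂ _*_ (P-descending r μ x) (P^-descending r μ n x) ⟩
    descending r (λ t → P-coeff r t * ℕ→ℚ μ ^ℚ t) x * descending (n ℕ.* r) (λ t → P^-coeff r n t * ℕ→ℚ μ ^ℚ t) x
      ≡⟨ descending-* r (n ℕ.* r) _ _ x
           (λ t r<t → trans (cong (_* ℕ→ℚ μ ^ℚ t) (P-coeff-vanishes r t r<t)) (*-zeroˡ (ℕ→ℚ μ ^ℚ t)))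
           (λ t nr<t → trans (cong (_* ℕ→ℚ μ ^ℚ t) (P^-coeff-vanishes r n t nr<t)) (*-zeroˡ (ℕ→ℚ μ ^ℚ t))) ⟩
    descending (suc n ℕ.* r) (convolution (λ t → P-coeff r t * ℕ→ℚ μ ^ℚ t) (λ t → P^-coeff r n t * ℕ→ℚ μ ^ℚ t)) x
      ≡⟨ descending-cong≤ (suc n ℕ.* r) x (λ u _ → convolution-^ (P-coeff r) (P^-coeff r n) (ℕ→ℚ μ) u) ⟩
    descending (suc n ℕ.* r) (λ t → P^-coeff r (suc n) t * ℕ→ℚ μ ^ℚ t) x ∎
    where open ≡-Reasoning

  P^-coeff-0 : ∀ r n → P^-coeff r n 0 ≡ 1ℚ
  P^-coeff-0 r zero    = δ-refl 0
  P^-coeff-0 r (suc n) = trans (cong₂ _*_ (P-coeff-0 r) (P^-coeff-0 r n)) (*-identityˡ 1ℚ)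

  P^-coeff-suc : ∀ r n t → P^-coeff r (suc n) (suc t) ≡ P^-coeff r n (suc t) + sumTo t (λ j → P-coeff r (suc j) * P^-coeff r n (t ℕ.∸ j))
  P^-coeff-suc r n t = trans (sumTo-suc t (λ j → P-coeff r j * P^-coeff r n (suc t ℕ.∸ j)))
                           (cong (_+ sumTo t (λ j → P-coeff r (suc j) * P^-coeff r n (t ℕ.∸ j)))
                                 (trans (cong (_* P^-coeff r n (suc t)) (P-coeff-0 r)) (*-identityˡ (P^-coeff r n (suc t)))))

  P^-coeff-poly : ∀ r t → Newton.Poly≤ t (λ n → P^-coeff r n t)
  P^-coeff-poly r = <-rec (λ t → Newton.Poly≤ t (λ n → P^-coeff r n t)) poly
    where
    poly : ∀ t → (∀ {s} → s < t → Newton.Poly≤ s (λ n → P^-coeff r n s)) → Newton.Poly≤ t (λ n → P^-coeff r n t)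
    poly zero    _   = Newton.Poly≤-cong (λ n → sym (P^-coeff-0 r n)) (Newton.Poly≤-const 1ℚ)
    poly (suc t) rec = Newton-telescope (λ n → P^-coeff-suc r n t)
      (Newton.Poly≤-sum t (λ j _ → Newton.Poly≤-mono (ℕ.m∸n≤m t j)
        (Newton.Poly≤-scale (P-coeff r (suc j)) (rec (s≤s (ℕ.m∸n≤m t j))))))

  -- Iterated differences

  Δ^-cong : ∀ h k {F G : ℚ → ℚ} → (∀ x → F x ≡ G x) → ∀ l → Δ^ h k F l ≡ Δ^ h k G l
  Δ^-cong h zero    F≡G l = F≡G l
  Δ^-cong h (suc k) F≡G l = cong₂ _-_ (Δ^-cong h k F≡G l) (Δ^-cong h k F≡G (l - h))

  Δ^-+ : ∀ h k (F G : ℚ → ℚ) l → Δ^ h k (λ x → F x + G x) l ≡ Δ^ h k F l + Δ^ h k G l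
  Δ^-+ h zero    F G l = refl
  Δ^-+ h (suc k) F G l =
    trans (cong₂ _-_ (Δ^-+ h k F G l) (Δ^-+ h k F G (l - h)))
          (regroup (Δ^ h k F l) (Δ^ h k G l) (Δ^ h k F (l - h)) (Δ^ h k G (l - h)))
    where
    open +-*-Solver
    regroup : ∀ a b c d → (a + b) - (c + d) ≡ (a - c) + (b - d)
    regroup = solve 4 (λ a b c d → (a :+ b) :- (c :+ d) := (a :- c) :+ (b :- d)) refl

  Δ^-scale : ∀ h k c (F : ℚ → ℚ) l → Δ^ h k (λ x → c * F x) l ≡ c * Δ^ h k F l
  Δ^-scale h zero    c F l = refl
  Δ^-scale h (suc k) c F l =
    trans (cong₂ _-_ (Δ^-scale h k c F l) (Δ^-scale h k c F (l - h))) (factor c _ _)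
    where
    open +-*-Solver
    factor : ∀ c a b → c * a - c * b ≡ c * (a - b)
    factor = solve 3 (λ c a b → c :* a :- c :* b := c :* (a :- b)) refl

  Δ^-sumTo : ∀ h k n (F : ℕ → ℚ → ℚ) l → Δ^ h k (λ x → sumTo n (λ t → F t x)) l ≡ sumTo n (λ t → Δ^ h k (F t) l)
  Δ^-sumTo h k zero    F l = refl
  Δ^-sumTo h k (suc n) F l =
    trans (Δ^-+ h k (λ x → sumTo n (λ t → F t x)) (F (suc n)) l) (cong (_+ Δ^ h k (F (suc n)) l) (Δ^-sumTo h k n F l))

  Δ^-const : ∀ h k c l → Δ^ h (suc k) (λ _ → c) l ≡ 0ℚ
  Δ^-const h zero    c l = +-inverseʳ c
  Δ^-const h (suc k) c l = trans (cong₂ _-_ (Δ^-const h k c l) (Δ^-const h k c (l - h))) (+-inverseʳ 0ℚ)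

  Δ^-*id : ∀ h k (g : ℚ → ℚ) l →
    Δ^ h (suc k) (λ x → x * g x) l ≡ (l - ℕ→ℚ (suc k) * h) * Δ^ h (suc k) g l + ℕ→ℚ (suc k) * h * Δ^ h k g l
  Δ^-*id h zero    g l = leibniz l h (g l) (g (l - h))
    where
    open +-*-Solver
    leibniz : ∀ l h a b → l * a - (l - h) * b ≡ (l - 1ℚ * h) * (a - b) + 1ℚ * h * a
    leibniz = solve 4 (λ l h a b → l :* a :- (l :- h) :* b := (l :- con 1ℚ :* h) :* (a :- b) :+ con 1ℚ :* h :* a) refl
  Δ^-*id h (suc k) g l =
    trans (cong₂ _-_ (Δ^-*id h k g l) (Δ^-*id h k g (l - h)))
    (trans (leibniz l h (ℕ→ℚ (suc k)) (Δ^ h k g l) (Δ^ h k g (l - h)) (Δ^ h k g (l - h - h)))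
           (cong (λ c → (l - c * h) * Δ^ h (suc (suc k)) g l + c * h * Δ^ h (suc k) g l) (sym (ℕ→ℚ-suc (suc k)))))
    where
    open +-*-Solver
    leibniz : ∀ l h c B B′ B″ → ((l - c * h) * (B - B′) + c * h * B) - ((l - h - c * h) * (B′ - B″) + c * h * B′)
              ≡ (l - (1ℚ + c) * h) * ((B - B′) - (B′ - B″)) + (1ℚ + c) * h * (B - B′)
    leibniz = solve 6 (λ l h c B B′ B″ → ((l :- c :* h) :* (B :- B′) :+ c :* h :* B)
                                          :- ((l :- h :- c :* h) :* (B′ :- B″) :+ c :* h :* B′)
                       := (l :- (con 1ℚ :+ c) :* h) :* ((B :- B′) :- (B′ :- B″)) :+ (con 1ℚ :+ c) :* h :* (B :- B′)) refl

  shiftUp : (ℕ → ℚ) → ℕ → ℚ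
  shiftUp h zero    = 0ℚ
  shiftUp h (suc a) = h a

  linear-*-powers : ∀ w c (h : ℕ → ℚ) l → h (suc w) ≡ 0ℚ →
    (l - c) * sumTo w (λ a → h a * l ^ℚ a) ≡ sumTo (suc w) (λ a → (shiftUp h a - c * h a) * l ^ℚ a)
  linear-*-powers w c h l h≡0 = begin
    (l - c) * S
      ≡⟨ distribute l c S ⟩
    l * S + - (c * S)
      ≡⟨ cong₂ _+_ raise lower ⟩
    sumTo (suc w) (λ a → shiftUp h a * l ^ℚ a) + sumTo (suc w) (λ a → - (c * h a) * l ^ℚ a)
      ≡⟨ sumTo-+ (suc w) _ _ ⟨
    sumTo (suc w) (λ a → shiftUp h a * l ^ℚ a + - (c * h a) * l ^ℚ a)
      ≡⟨ sumTo-cong (suc w) (λ a → *-distribʳ-+ (l ^ℚ a) (shiftUp h a) (- (c * h a))) ⟨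
    sumTo (suc w) (λ a → (shiftUp h a - c * h a) * l ^ℚ a) ∎
    where
    open ≡-Reasoning
    open +-*-Solver
    S : ℚ
    S = sumTo w (λ a → h a * l ^ℚ a)
    distribute : ∀ l c S → (l - c) * S ≡ l * S + - (c * S)
    distribute = solve 3 (λ l c S → (l :- c) :* S := l :* S :+ :- (c :* S)) refl
    raise : l * S ≡ sumTo (suc w) (λ a → shiftUp h a * l ^ℚ a)
    raise = begin
      l * S                                          ≡⟨ *-distribˡ-sumTo w l _ ⟩
      sumTo w (λ a → l * (h a * l ^ℚ a))             ≡⟨ sumTo-cong w (λ a → ℚ*.x∙yz≈y∙xz l (h a) (l ^ℚ a)) ⟩
      sumTo w (λ a → h a * l ^ℚ suc a)               ≡⟨ +-identityˡ _ ⟨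
      0ℚ * 1ℚ + sumTo w (λ a → h a * l ^ℚ suc a)     ≡⟨ sumTo-suc w (λ a → shiftUp h a * l ^ℚ a) ⟨
      sumTo (suc w) (λ a → shiftUp h a * l ^ℚ a)     ∎
    lower : - (c * S) ≡ sumTo (suc w) (λ a → - (c * h a) * l ^ℚ a)
    lower = begin
      - (c * S)                                                    ≡⟨ cong -_ (*-distribˡ-sumTo w c _) ⟩
      - sumTo w (λ a → c * (h a * l ^ℚ a))                         ≡⟨ neg-sumTo w _ ⟩
      sumTo w (λ a → - (c * (h a * l ^ℚ a)))
        ≡⟨ sumTo-cong w (λ a → trans (cong -_ (sym (*-assoc c (h a) (l ^ℚ a)))) (neg-distribˡ-* (c * h a) (l ^ℚ a))) ⟩
      sumTo w (λ a → - (c * h a) * l ^ℚ a)                         ≡⟨ +-identityʳ _ ⟨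
      sumTo w (λ a → - (c * h a) * l ^ℚ a) + 0ℚ                    ≡⟨ cong (sumTo w (λ a → - (c * h a) * l ^ℚ a) +_) top ⟨
      sumTo (suc w) (λ a → - (c * h a) * l ^ℚ a)                   ∎
      where
      top : - (c * h (suc w)) * l ^ℚ suc w ≡ 0ℚ
      top = trans (cong (λ t → - (c * t) * l ^ℚ suc w) h≡0) (trans (cong (λ t → - t * l ^ℚ suc w) (*-zeroʳ c)) (*-zeroˡ (l ^ℚ suc w)))

  module DividedDifference (q : ℕ) .{{q≢0 : NonZero q}} where

    weight : ℕ → ℚ
    weight k = 1/ℕ (q ℕ.^ k) {{ℕ.m^n≢0 q k}} * 1/ℕ (k !) {{k ℕ.!≢0}}

    divided : ℕ → (ℚ → ℚ) → ℚ → ℚ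
    divided k F l = weight k * Δ^ (ℕ→ℚ q) k F l

    node : ℕ → ℚ
    node k = ℕ→ℚ (suc k) * ℕ→ℚ q

    weight-suc : ∀ k → weight (suc k) * node k ≡ weight k
    weight-suc k = begin
      weight (suc k) * node k
        ≡⟨ cong₂ (λ u v → u * v * node k) (1/ℕ-homo-* q (q ℕ.^ k) {{q≢0}} {{ℕ.m^n≢0 q k}})
                                           (1/ℕ-homo-* (suc k) (k !) {{_}} {{k ℕ.!≢0}}) ⟩
      1/ℕ q * Q * (1/ℕ (suc k) * K) * (ℕ→ℚ (suc k) * ℕ→ℚ q)
        ≡⟨ regroup (1/ℕ q) Q (1/ℕ (suc k)) K (ℕ→ℚ (suc k)) (ℕ→ℚ q) ⟩
      (1/ℕ q * ℕ→ℚ q) * (1/ℕ (suc k) * ℕ→ℚ (suc k)) * (Q * K)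
        ≡⟨ cong₂ (λ u v → u * v * (Q * K)) (1/ℕ-inverseˡ q) (1/ℕ-inverseˡ (suc k)) ⟩
      1ℚ * 1ℚ * (Q * K)
        ≡⟨ *-identityˡ (Q * K) ⟩
      weight k ∎
      where
      open ≡-Reasoning
      open +-*-Solver
      Q : ℚ
      Q = 1/ℕ (q ℕ.^ k) {{ℕ.m^n≢0 q k}}
      K : ℚ
      K = 1/ℕ (k !) {{k ℕ.!≢0}}
      regroup : ∀ a b c d x y → a * b * (c * d) * (x * y) ≡ (a * y) * (c * x) * (b * d)
      regroup = solve 6 (λ a b c d x y → a :* b :* (c :* d) :* (x :* y) := (a :* y) :* (c :* x) :* (b :* d)) refl

    divided-^-suc : ∀ k n l → divided (suc k) (λ x → x ^ℚ suc n) l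
                              ≡ (l - node k) * divided (suc k) (λ x → x ^ℚ n) l + divided k (λ x → x ^ℚ n) l
    divided-^-suc k n l = begin
      weight (suc k) * Δ^ (ℕ→ℚ q) (suc k) (λ x → x * x ^ℚ n) l
        ≡⟨ cong (weight (suc k) *_) (Δ^-*id (ℕ→ℚ q) k (λ x → x ^ℚ n) l) ⟩
      weight (suc k) * ((l - node k) * D₁ + node k * D₀)
        ≡⟨ distribute (weight (suc k)) l (node k) D₁ D₀ ⟩
      (l - node k) * (weight (suc k) * D₁) + (weight (suc k) * node k) * D₀
        ≡⟨ cong (λ w → (l - node k) * (weight (suc k) * D₁) + w * D₀) (weight-suc k) ⟩
      (l - node k) * divided (suc k) (λ x → x ^ℚ n) l + divided k (λ x → x ^ℚ n) l ∎
      where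
      open ≡-Reasoning
      open +-*-Solver
      D₁ : ℚ
      D₁ = Δ^ (ℕ→ℚ q) (suc k) (λ x → x ^ℚ n) l
      D₀ : ℚ
      D₀ = Δ^ (ℕ→ℚ q) k (λ x → x ^ℚ n) l
      distribute : ∀ w l c a b → w * ((l - c) * a + c * b) ≡ (l - c) * (w * a) + (w * c) * b
      distribute = solve 5 (λ w l c a b → w :* ((l :- c) :* a :+ c :* b) := (l :- c) :* (w :* a) :+ (w :* c) :* b) refl

    divided-^-vanishes : ∀ k n l → n < k → divided k (λ x → x ^ℚ n) l ≡ 0ℚ
    divided-^-vanishes (suc k) zero    l _ = trans (cong (weight (suc k) *_) (Δ^-const (ℕ→ℚ q) k 1ℚ l)) (*-zeroʳ (weight (suc k)))
    divided-^-vanishes (suc k) (suc n) l (s≤s n<k) = begin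
      divided (suc k) (λ x → x ^ℚ suc n) l
        ≡⟨ divided-^-suc k n l ⟩
      (l - node k) * divided (suc k) (λ x → x ^ℚ n) l + divided k (λ x → x ^ℚ n) l
        ≡⟨ cong₂ (λ u v → (l - node k) * u + v) (divided-^-vanishes (suc k) n l (ℕ.m<n⇒m<1+n n<k)) (divided-^-vanishes k n l n<k) ⟩
      (l - node k) * 0ℚ + 0ℚ
        ≡⟨ trans (+-identityʳ ((l - node k) * 0ℚ)) (*-zeroʳ (l - node k)) ⟩
      0ℚ ∎
      where open ≡-Reasoning

    divided-0 : ∀ F l → divided 0 F l ≡ F l
    divided-0 F l = *-identityˡ (F l)

    divided-^-self : ∀ k l → divided k (λ x → x ^ℚ k) l ≡ 1ℚ
    divided-^-self zero    l = refl
    divided-^-self (suc k) l = begin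
      divided (suc k) (λ x → x ^ℚ suc k) l
        ≡⟨ divided-^-suc k k l ⟩
      (l - node k) * divided (suc k) (λ x → x ^ℚ k) l + divided k (λ x → x ^ℚ k) l
        ≡⟨ cong₂ (λ u v → (l - node k) * u + v) (divided-^-vanishes (suc k) k l (ℕ.n<1+n k)) (divided-^-self k l) ⟩
      (l - node k) * 0ℚ + 1ℚ
        ≡⟨ cong (_+ 1ℚ) (*-zeroʳ (l - node k)) ⟩
      1ℚ ∎
      where open ≡-Reasoning

    divided-^-step : ∀ k w l → divided (suc k) (λ x → x ^ℚ (suc k ℕ.+ suc w)) l
                               ≡ divided k (λ x → x ^ℚ (k ℕ.+ suc w)) l + (l - node k) * divided (suc k) (λ x → x ^ℚ (suc k ℕ.+ w)) l
    divided-^-step k w l rewrite ℕ.+-suc k w =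
      trans (divided-^-suc k (suc (k ℕ.+ w)) l) (+-comm _ (divided k (λ x → x ^ℚ suc (k ℕ.+ w)) l))

    -- The coefficient of l ^ a in divided k (λ x → x ^ℚ (k + w)) l; its recursion is divided-^-step.
    divided-coeff : ℕ → ℕ → ℕ → ℚ
    divided-coeff zero    a k       = δ 0 a
    divided-coeff (suc w) a zero    = δ (suc w) a
    divided-coeff (suc w) a (suc k) =
      divided-coeff (suc w) a k + (shiftUp (λ b → divided-coeff w b (suc k)) a - node k * divided-coeff w a (suc k))

    divided-coeff-vanishes : ∀ w a k → w < a → divided-coeff w a k ≡ 0ℚ
    divided-coeff-vanishes zero    a       k       0<a = δ-≢ (ℕ.<⇒≢ 0<a)
    divided-coeff-vanishes (suc w) a       zero    w<a = δ-≢ (ℕ.<⇒≢ w<a)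
    divided-coeff-vanishes (suc w) (suc a) (suc k) (s≤s w<a) = begin
      divided-coeff (suc w) (suc a) k + (divided-coeff w a (suc k) - node k * divided-coeff w (suc a) (suc k))
        ≡⟨ cong₂ (λ u v → u + (v - node k * divided-coeff w (suc a) (suc k)))
                 (divided-coeff-vanishes (suc w) (suc a) k (s≤s w<a)) (divided-coeff-vanishes w a (suc k) w<a) ⟩
      0ℚ + (0ℚ - node k * divided-coeff w (suc a) (suc k))
        ≡⟨ cong (λ u → 0ℚ + (0ℚ - node k * u)) (divided-coeff-vanishes w (suc a) (suc k) (ℕ.m<n⇒m<1+n w<a)) ⟩
      0ℚ + (0ℚ - node k * 0ℚ)
        ≡⟨ cong (λ u → 0ℚ + (0ℚ - u)) (*-zeroʳ (node k)) ⟩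
      0ℚ ∎
      where open ≡-Reasoning

    divided-^-expansion : ∀ w k l → divided k (λ x → x ^ℚ (k ℕ.+ w)) l ≡ sumTo w (λ a → divided-coeff w a k * l ^ℚ a)
    divided-^-expansion zero    k       l = begin
      divided k (λ x → x ^ℚ (k ℕ.+ 0)) l
        ≡⟨ cong (weight k *_) (Δ^-cong (ℕ→ℚ q) k (λ x → cong (x ^ℚ_) (ℕ.+-identityʳ k)) l) ⟩
      divided k (λ x → x ^ℚ k) l             ≡⟨ divided-^-self k l ⟩
      1ℚ                                     ≡⟨ cong (_* 1ℚ) (δ-refl 0) ⟨
      δ 0 0 * 1ℚ                             ∎
      where open ≡-Reasoning
    divided-^-expansion (suc w) zero    l = trans (divided-0 (λ x → x ^ℚ suc w) l) (sym (sumTo-δ (suc w) (l ^ℚ_)))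
    divided-^-expansion (suc w) (suc k) l = begin
      divided (suc k) (λ x → x ^ℚ (suc k ℕ.+ suc w)) l
        ≡⟨ divided-^-step k w l ⟩
      divided k (λ x → x ^ℚ (k ℕ.+ suc w)) l + (l - node k) * divided (suc k) (λ x → x ^ℚ (suc k ℕ.+ w)) l
        ≡⟨ cong₂ (λ u v → u + (l - node k) * v) (divided-^-expansion (suc w) k l) (divided-^-expansion w (suc k) l) ⟩
      sumTo (suc w) (λ a → divided-coeff (suc w) a k * l ^ℚ a) + (l - node k) * sumTo w (λ a → divided-coeff w a (suc k) * l ^ℚ a)
        ≡⟨ cong (sumTo (suc w) (λ a → divided-coeff (suc w) a k * l ^ℚ a) +_)
                (linear-*-powers w (node k) (λ a → divided-coeff w a (suc k)) l (divided-coeff-vanishes w (suc w) (suc k) (ℕ.n<1+n w))) ⟩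
      sumTo (suc w) (λ a → divided-coeff (suc w) a k * l ^ℚ a) + sumTo (suc w) (λ a → new a * l ^ℚ a)
        ≡⟨ sumTo-+ (suc w) _ _ ⟨
      sumTo (suc w) (λ a → divided-coeff (suc w) a k * l ^ℚ a + new a * l ^ℚ a)
        ≡⟨ sumTo-cong (suc w) (λ a → *-distribʳ-+ (l ^ℚ a) (divided-coeff (suc w) a k) (new a)) ⟨
      sumTo (suc w) (λ a → divided-coeff (suc w) a (suc k) * l ^ℚ a) ∎
      where
      open ≡-Reasoning
      new : ℕ → ℚ
      new a = shiftUp (λ b → divided-coeff w b (suc k)) a - node k * divided-coeff w a (suc k)

    divided-coeff-diagonal : ∀ w k → divided-coeff w w k ≡ ℕ→ℚ ((k ℕ.+ w) C w)
    divided-coeff-diagonal zero    k       = δ-refl 0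
    divided-coeff-diagonal (suc w) zero    = trans (δ-refl (suc w)) (cong ℕ→ℚ (sym (nCn≡1 (suc w))))
    divided-coeff-diagonal (suc w) (suc k) = begin
      divided-coeff (suc w) (suc w) k + (divided-coeff w w (suc k) - node k * divided-coeff w (suc w) (suc k))
        ≡⟨ cong (λ u → divided-coeff (suc w) (suc w) k + (divided-coeff w w (suc k) - u))
                (trans (cong (node k *_) (divided-coeff-vanishes w (suc w) (suc k) (ℕ.n<1+n w))) (*-zeroʳ (node k))) ⟩
      divided-coeff (suc w) (suc w) k + (divided-coeff w w (suc k) - 0ℚ)
        ≡⟨ cong₂ (λ u v → u + (v - 0ℚ)) (divided-coeff-diagonal (suc w) k) (divided-coeff-diagonal w (suc k)) ⟩
      ℕ→ℚ ((k ℕ.+ suc w) C suc w) + (ℕ→ℚ (N C w) - 0ℚ)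
        ≡⟨ cong₂ _+_ (cong (λ n → ℕ→ℚ (n C suc w)) (ℕ.+-suc k w)) (+-identityʳ (ℕ→ℚ (N C w))) ⟩
      ℕ→ℚ (N C suc w) + ℕ→ℚ (N C w)
        ≡⟨ trans (+-comm (ℕ→ℚ (N C suc w)) (ℕ→ℚ (N C w))) (sym (ℕ→ℚ-homo-+ (N C w) (N C suc w))) ⟩
      ℕ→ℚ (N C w ℕ.+ N C suc w)
        ≡⟨ cong ℕ→ℚ (nCk+nC[k+1]≡[n+1]C[k+1] N w) ⟩
      ℕ→ℚ (suc N C suc w)
        ≡⟨ cong (λ n → ℕ→ℚ (suc n C suc w)) (ℕ.+-suc k w) ⟨
      ℕ→ℚ ((suc k ℕ.+ suc w) C suc w) ∎
      where
      open ≡-Reasoning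
      N : ℕ
      N = suc (k ℕ.+ w)

    Newton-*node : ∀ {e g} → Newton.Poly≤ e g → Newton.Poly≤ (suc e) (λ k → node k * g k)
    Newton-*node {g = g} P = Newton.Poly≤-cong (λ k → cong (_* g k) (as-linear k)) (Newton-*linear (ℕ→ℚ q) (ℕ→ℚ q) P)
      where
      as-linear : ∀ k → ℕ→ℚ q * ℕ→ℚ k + ℕ→ℚ q ≡ node k
      as-linear k = trans (solve 2 (λ q k → q :* k :+ q := (con 1ℚ :+ k) :* q) refl (ℕ→ℚ q) (ℕ→ℚ k))
                          (cong (_* ℕ→ℚ q) (sym (ℕ→ℚ-suc k)))
        where open +-*-Solver

    divided-coeff-poly : ∀ w a → a ≤ w → Newton.Poly≤ (w ℕ.+ (w ℕ.∸ a)) (divided-coeff w a)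
    divided-coeff-poly zero    zero    z≤n  = Newton.Poly≤-cong (λ _ → sym (δ-refl 0)) (Newton.Poly≤-const 1ℚ)
    divided-coeff-poly (suc w) a       a≤1+w =
      Newton-telescope (λ k → refl)
        (Newton.Poly≤-cong (λ k → minus (shiftUp (λ b → divided-coeff w b (suc k)) a) (node k * divided-coeff w a (suc k)))
          (Newton.Poly≤-+ (shifted-poly a a≤1+w) (Newton.Poly≤-scale (- 1ℚ) (node-poly a (a ℕ.≤? w)))))
      where
      minus : ∀ x y → x + - 1ℚ * y ≡ x - y
      minus = solve 2 (λ x y → x :+ :- con 1ℚ :* y := x :- y) refl
        where open +-*-Solver
      shifted-poly : ∀ a → a ≤ suc w → Newton.Poly≤ (w ℕ.+ (suc w ℕ.∸ a)) (λ k → shiftUp (λ b → divided-coeff w b (suc k)) a)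
      shifted-poly zero    _         = Newton.Poly≤-zero _ (λ _ → refl)
      shifted-poly (suc b) (s≤s b≤w) = Newton-shift (divided-coeff-poly w b b≤w)
      node-poly : ∀ a → Dec (a ≤ w) → Newton.Poly≤ (w ℕ.+ (suc w ℕ.∸ a)) (λ k → node k * divided-coeff w a (suc k))
      node-poly a (yes a≤w) = Newton.Poly≤-mono (ℕ.≤-reflexive degree) (Newton-*node (Newton-shift (divided-coeff-poly w a a≤w)))
        where
        degree : suc (w ℕ.+ (w ℕ.∸ a)) ≡ w ℕ.+ (suc w ℕ.∸ a)
        degree = trans (sym (ℕ.+-suc w (w ℕ.∸ a))) (cong (w ℕ.+_) (sym (ℕ.+-∸-assoc 1 a≤w)))
      node-poly a (no a≰w) =
        Newton.Poly≤-zero _ (λ k → trans (cong (node k *_) (divided-coeff-vanishes w a (suc k) (ℕ.≰⇒> a≰w))) (*-zeroʳ (node k)))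

    divided-descending : ∀ k n c l → divided k (descending n c) l ≡ sumTo n (λ t → c t * divided k (λ x → x ^ℚ (n ℕ.∸ t)) l)
    divided-descending k n c l = begin
      weight k * Δ^ (ℕ→ℚ q) k (λ x → sumTo n (λ t → c t * x ^ℚ (n ℕ.∸ t))) l
        ≡⟨ cong (weight k *_) (Δ^-sumTo (ℕ→ℚ q) k n (λ t x → c t * x ^ℚ (n ℕ.∸ t)) l) ⟩
      weight k * sumTo n (λ t → Δ^ (ℕ→ℚ q) k (λ x → c t * x ^ℚ (n ℕ.∸ t)) l)
        ≡⟨ cong (weight k *_) (sumTo-cong n (λ t → Δ^-scale (ℕ→ℚ q) k (c t) (λ x → x ^ℚ (n ℕ.∸ t)) l)) ⟩
      weight k * sumTo n (λ t → c t * Δ^ (ℕ→ℚ q) k (λ x → x ^ℚ (n ℕ.∸ t)) l)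
        ≡⟨ *-distribˡ-sumTo n (weight k) _ ⟩
      sumTo n (λ t → weight k * (c t * Δ^ (ℕ→ℚ q) k (λ x → x ^ℚ (n ℕ.∸ t)) l))
        ≡⟨ sumTo-cong n (λ t → ℚ*.x∙yz≈y∙xz (weight k) (c t) _) ⟩
      sumTo n (λ t → c t * divided k (λ x → x ^ℚ (n ℕ.∸ t)) l) ∎
      where open ≡-Reasoning

    divided-descending-vanishes : ∀ k n c l → n < k → divided k (descending n c) l ≡ 0ℚ
    divided-descending-vanishes k n c l n<k = trans (divided-descending k n c l) (sumTo-zero n (λ t _ →
      trans (cong (c t *_) (divided-^-vanishes k (n ℕ.∸ t) l (ℕ.≤-<-trans (ℕ.m∸n≤m n t) n<k))) (*-zeroʳ (c t))))

    divided-descending-expansion : ∀ k d c l →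
      divided k (descending (k ℕ.+ d) c) l ≡ sumTo d (λ a → l ^ℚ a * sumTo d (λ t → c t * divided-coeff (d ℕ.∸ t) a k))
    divided-descending-expansion k d c l = begin
      divided k (descending (k ℕ.+ d) c) l
        ≡⟨ divided-descending k (k ℕ.+ d) c l ⟩
      sumTo (k ℕ.+ d) (λ t → c t * divided k (λ x → x ^ℚ (k ℕ.+ d ℕ.∸ t)) l)
        ≡⟨ sumTo-extend (ℕ.m≤n+m d k) (λ t d<t t≤k+d →
             trans (cong (c t *_) (divided-^-vanishes k (k ℕ.+ d ℕ.∸ t) l (low-power d<t t≤k+d))) (*-zeroʳ (c t))) ⟩
      sumTo d (λ t → c t * divided k (λ x → x ^ℚ (k ℕ.+ d ℕ.∸ t)) l)
        ≡⟨ sumTo-cong≤ d (λ t t≤d → cong (c t *_) (expand t t≤d)) ⟩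
      sumTo d (λ t → c t * sumTo d (λ a → divided-coeff (d ℕ.∸ t) a k * l ^ℚ a))
        ≡⟨ sumTo-cong d (λ t → *-distribˡ-sumTo d (c t) _) ⟩
      sumTo d (λ t → sumTo d (λ a → c t * (divided-coeff (d ℕ.∸ t) a k * l ^ℚ a)))
        ≡⟨ sumTo-comm d d _ ⟩
      sumTo d (λ a → sumTo d (λ t → c t * (divided-coeff (d ℕ.∸ t) a k * l ^ℚ a)))
        ≡⟨ sumTo-cong d (λ a → trans (sumTo-cong d (λ t → regroup (c t) (divided-coeff (d ℕ.∸ t) a k) (l ^ℚ a)))
                                     (sym (*-distribˡ-sumTo d (l ^ℚ a) _))) ⟩
      sumTo d (λ a → l ^ℚ a * sumTo d (λ t → c t * divided-coeff (d ℕ.∸ t) a k)) ∎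
      where
      open ≡-Reasoning
      regroup : ∀ x y z → x * (y * z) ≡ z * (x * y)
      regroup x y z = ℚ*.x∙yz≈z∙xy x y z
      low-power : ∀ {t} → d < t → t ≤ k ℕ.+ d → k ℕ.+ d ℕ.∸ t < k
      low-power {t} d<t t≤k+d = subst (k ℕ.+ d ℕ.∸ t <_) (ℕ.m+n∸n≡m k t) (ℕ.∸-monoˡ-< (ℕ.+-monoʳ-< k d<t) t≤k+d)
      expand : ∀ t → t ≤ d →
               divided k (λ x → x ^ℚ (k ℕ.+ d ℕ.∸ t)) l ≡ sumTo d (λ a → divided-coeff (d ℕ.∸ t) a k * l ^ℚ a)
      expand t t≤d = begin
        divided k (λ x → x ^ℚ (k ℕ.+ d ℕ.∸ t)) l
          ≡⟨ cong (weight k *_) (Δ^-cong (ℕ→ℚ q) k (λ x → cong (x ^ℚ_) (ℕ.+-∸-assoc k t≤d)) l) ⟩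
        divided k (λ x → x ^ℚ (k ℕ.+ (d ℕ.∸ t))) l
          ≡⟨ divided-^-expansion (d ℕ.∸ t) k l ⟩
        sumTo (d ℕ.∸ t) (λ a → divided-coeff (d ℕ.∸ t) a k * l ^ℚ a)
          ≡⟨ sumTo-extend (ℕ.m∸n≤m d t) (λ a d∸t<a _ →
               trans (cong (_* l ^ℚ a) (divided-coeff-vanishes (d ℕ.∸ t) a k d∸t<a)) (*-zeroˡ (l ^ℚ a))) ⟨
        sumTo d (λ a → divided-coeff (d ℕ.∸ t) a k * l ^ℚ a) ∎

  IsPolyOfDegree-negative : ∀ {n f} → 0 < n → (∀ m l → f m l ≡ 0ℚ) → IsPolyOfDegree (ℤ.- ℤ.+ n) f
  IsPolyOfDegree-negative {suc n} _ f≡0 = f≡0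

  double-⊖-≥ : ∀ {m n} → n ≤ m → (2 ℕ.* m) ℤ.⊖ (2 ℕ.* n) ≡ ℤ.+ ((m ℕ.∸ n) ℕ.+ (m ℕ.∸ n))
  double-⊖-≥ {m} {n} n≤m = begin
    (2 ℕ.* m) ℤ.⊖ (2 ℕ.* n)        ≡⟨ ℤ.⊖-≥ (ℕ.*-monoʳ-≤ 2 n≤m) ⟩
    ℤ.+ (2 ℕ.* m ℕ.∸ 2 ℕ.* n)      ≡⟨ cong ℤ.+_ (ℕ.*-distribˡ-∸ 2 m n) ⟨
    ℤ.+ (2 ℕ.* (m ℕ.∸ n))          ≡⟨ cong (λ k → ℤ.+ ((m ℕ.∸ n) ℕ.+ k)) (ℕ.+-identityʳ (m ℕ.∸ n)) ⟩
    ℤ.+ ((m ℕ.∸ n) ℕ.+ (m ℕ.∸ n))  ∎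
    where open ≡-Reasoning

  statement-degree : ∀ r s i e → ℤ.+ (2 ℕ.* r ℕ.* s) ℤ.- ℤ.+ (2 ℕ.* i) ℤ.- ℤ.+ (2 ℕ.* e)
                                 ≡ (2 ℕ.* (r ℕ.* s)) ℤ.⊖ (2 ℕ.* (i ℕ.+ e))
  statement-degree r s i e = begin
    ℤ.+ (2 ℕ.* r ℕ.* s) ℤ.- ℤ.+ (2 ℕ.* i) ℤ.- ℤ.+ (2 ℕ.* e)
      ≡⟨ ℤ.+-assoc (ℤ.+ (2 ℕ.* r ℕ.* s)) (ℤ.- ℤ.+ (2 ℕ.* i)) (ℤ.- ℤ.+ (2 ℕ.* e)) ⟩
    ℤ.+ (2 ℕ.* r ℕ.* s) ℤ.+ (ℤ.- ℤ.+ (2 ℕ.* i) ℤ.+ ℤ.- ℤ.+ (2 ℕ.* e))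
      ≡⟨ cong (λ z → ℤ.+ (2 ℕ.* r ℕ.* s) ℤ.+ z) (ℤ.neg-distrib-+ (ℤ.+ (2 ℕ.* i)) (ℤ.+ (2 ℕ.* e))) ⟨
    ℤ.+ (2 ℕ.* r ℕ.* s) ℤ.- ℤ.+ (2 ℕ.* i ℕ.+ 2 ℕ.* e)
      ≡⟨ ℤ.m-n≡m⊖n (2 ℕ.* r ℕ.* s) (2 ℕ.* i ℕ.+ 2 ℕ.* e) ⟩
    (2 ℕ.* r ℕ.* s) ℤ.⊖ (2 ℕ.* i ℕ.+ 2 ℕ.* e)
      ≡⟨ cong₂ ℤ._⊖_ (ℕ.*-assoc 2 r s) (sym (ℕ.*-distribˡ-+ 2 i e)) ⟩
    (2 ℕ.* (r ℕ.* s)) ℤ.⊖ (2 ℕ.* (i ℕ.+ e)) ∎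
    where open ≡-Reasoning

  module Expression (q r i s η : ℕ) .{{q≢0 : NonZero q}} .{{r≢0 : NonZero r}} where

    open DividedDifference q

    c₀ : ℕ
    c₀ = i ℕ.+ η ℕ./ q

    order : ℕ → ℕ
    order m = r ℕ.* m ℕ.+ c₀

    coefficient : ℕ → ℕ → ℚ
    coefficient m t = P^-coeff r (s ℕ.+ m) t * ℕ→ℚ (muOf q r η m) ^ℚ t

    order-≡ : ∀ m → i ℕ.+ floorQ q (muOf q r η m) ≡ order m
    order-≡ m = begin
      i ℕ.+ (q ℕ.* r ℕ.* m ℕ.+ η) ℕ./ q                 ≡⟨ cong (λ n → i ℕ.+ (n ℕ.+ η) ℕ./ q) (qrm≡rmq q r m) ⟩
      i ℕ.+ (r ℕ.* m ℕ.* q ℕ.+ η) ℕ./ q                 ≡⟨ cong (i ℕ.+_) (+-distrib-/-∣ˡ η (n∣m*n (r ℕ.* m))) ⟩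
      i ℕ.+ (r ℕ.* m ℕ.* q ℕ./ q ℕ.+ η ℕ./ q)           ≡⟨ cong (λ n → i ℕ.+ (n ℕ.+ η ℕ./ q)) (m*n/n≡m (r ℕ.* m) q) ⟩
      i ℕ.+ (r ℕ.* m ℕ.+ η ℕ./ q)                       ≡⟨ reorder i (r ℕ.* m) (η ℕ./ q) ⟩
      order m                                          ∎
      where
      open ≡-Reasoning
      open ℕ-Solver.+-*-Solver
      qrm≡rmq : ∀ q r m → q ℕ.* r ℕ.* m ≡ r ℕ.* m ℕ.* q
      qrm≡rmq = solve 3 (λ q r m → q :* r :* m := r :* m :* q) refl
      reorder : ∀ i x e → i ℕ.+ (x ℕ.+ e) ≡ x ℕ.+ (i ℕ.+ e)
      reorder = solve 3 (λ i x e → i :+ (x :+ e) := x :+ (i :+ e)) refl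

    expr-divided : ∀ m l → expr q r i s η m l ≡ divided (order m) (descending ((s ℕ.+ m) ℕ.* r) (coefficient m)) l
    expr-divided m l = begin
      expr q r i s η m l
        ≡⟨ cong (λ k → divided k (λ x → Pμ r (muOf q r η m) x ^ℚ (s ℕ.+ m)) l) (order-≡ m) ⟩
      divided (order m) (λ x → Pμ r (muOf q r η m) x ^ℚ (s ℕ.+ m)) l
        ≡⟨ cong (weight (order m) *_) (Δ^-cong (ℕ→ℚ q) (order m) (λ x → P^-descending r (muOf q r η m) (s ℕ.+ m) x) l) ⟩
      divided (order m) (descending ((s ℕ.+ m) ℕ.* r) (coefficient m)) l ∎
      where open ≡-Reasoning

    degree-≡ : ∀ m → (s ℕ.+ m) ℕ.* r ≡ r ℕ.* m ℕ.+ r ℕ.* s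
    degree-≡ m = solve 3 (λ s m r → (s :+ m) :* r := r :* m :+ r :* s) refl s m r
      where open ℕ-Solver.+-*-Solver

    expr-vanishes : r ℕ.* s < c₀ → ∀ m l → expr q r i s η m l ≡ 0ℚ
    expr-vanishes rs<c₀ m l = trans (expr-divided m l)
      (divided-descending-vanishes (order m) _ (coefficient m) l
        (subst (_< order m) (sym (degree-≡ m)) (ℕ.+-monoʳ-< (r ℕ.* m) rs<c₀)))

    module _ (c₀≤rs : c₀ ≤ r ℕ.* s) where

      d : ℕ
      d = r ℕ.* s ℕ.∸ c₀

      l-coeff : ℕ → ℕ → ℚ
      l-coeff a m = sumTo d (λ t → coefficient m t * divided-coeff (d ℕ.∸ t) a (order m))

      l-coeff-vanishes : ∀ a m → d < a → l-coeff a m ≡ 0ℚ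
      l-coeff-vanishes a m d<a = sumTo-zero d (λ t _ →
        trans (cong (coefficient m t *_) (divided-coeff-vanishes (d ℕ.∸ t) a (order m) (ℕ.≤-<-trans (ℕ.m∸n≤m d t) d<a)))
              (*-zeroʳ (coefficient m t)))

      expr-expansion : ∀ m l → expr q r i s η m l ≡ sumTo (d ℕ.+ d) (λ a → l ^ℚ a * l-coeff a m)
      expr-expansion m l = begin
        expr q r i s η m l
          ≡⟨ expr-divided m l ⟩
        divided (order m) (descending ((s ℕ.+ m) ℕ.* r) (coefficient m)) l
          ≡⟨ cong (λ n → divided (order m) (descending n (coefficient m)) l) top-degree ⟩
        divided (order m) (descending (order m ℕ.+ d) (coefficient m)) l
          ≡⟨ divided-descending-expansion (order m) d (coefficient m) l ⟩
        sumTo d (λ a → l ^ℚ a * l-coeff a m)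
          ≡⟨ sumTo-extend (ℕ.m≤m+n d d) (λ a d<a _ → trans (cong (l ^ℚ a *_) (l-coeff-vanishes a m d<a)) (*-zeroʳ (l ^ℚ a))) ⟨
        sumTo (d ℕ.+ d) (λ a → l ^ℚ a * l-coeff a m) ∎
        where
        open ≡-Reasoning
        top-degree : (s ℕ.+ m) ℕ.* r ≡ order m ℕ.+ d
        top-degree = begin
          (s ℕ.+ m) ℕ.* r                    ≡⟨ degree-≡ m ⟩
          r ℕ.* m ℕ.+ r ℕ.* s                ≡⟨ cong (r ℕ.* m ℕ.+_) (ℕ.m+[n∸m]≡n c₀≤rs) ⟨
          r ℕ.* m ℕ.+ (c₀ ℕ.+ d)             ≡⟨ ℕ.+-assoc (r ℕ.* m) c₀ d ⟨
          order m ℕ.+ d                      ∎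

      term-degree : ∀ {t a} → t ≤ d → a ≤ d ℕ.∸ t →
                    (t ℕ.+ t) ℕ.+ ((d ℕ.∸ t) ℕ.+ ((d ℕ.∸ t) ℕ.∸ a)) ≡ d ℕ.+ (d ℕ.∸ a)
      term-degree {t} {a} t≤d a≤d∸t = begin
        (t ℕ.+ t) ℕ.+ (u ℕ.+ (u ℕ.∸ a))       ≡⟨ interchange t u (u ℕ.∸ a) ⟩
        (t ℕ.+ u) ℕ.+ (t ℕ.+ (u ℕ.∸ a))       ≡⟨ cong ((t ℕ.+ u) ℕ.+_) (ℕ.+-∸-assoc t a≤d∸t) ⟨
        (t ℕ.+ u) ℕ.+ ((t ℕ.+ u) ℕ.∸ a)       ≡⟨ cong (λ n → n ℕ.+ (n ℕ.∸ a)) (ℕ.m+[n∸m]≡n t≤d) ⟩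
        d ℕ.+ (d ℕ.∸ a)                       ∎
        where
        open ≡-Reasoning
        open ℕ-Solver.+-*-Solver
        u : ℕ
        u = d ℕ.∸ t
        interchange : ∀ t u v → (t ℕ.+ t) ℕ.+ (u ℕ.+ v) ≡ (t ℕ.+ u) ℕ.+ (t ℕ.+ v)
        interchange = solve 3 (λ t u v → (t :+ t) :+ (u :+ v) := (t :+ u) :+ (t :+ v)) refl

      term-poly : ∀ t a → t ≤ d → Dec (a ≤ d ℕ.∸ t) →
                  Newton.Poly≤ (d ℕ.+ (d ℕ.∸ a)) (λ m → coefficient m t * divided-coeff (d ℕ.∸ t) a (order m))
      term-poly t a t≤d (yes a≤d∸t) =
        Newton.Poly≤-mono (ℕ.≤-reflexive (term-degree t≤d a≤d∸t))
          (Newton-* (Newton-* shifted-power (Newton-affine-^ (q ℕ.* r) η t))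
                    (Newton-∘affine r c₀ (divided-coeff-poly (d ℕ.∸ t) a a≤d∸t)))
        where
        [1*m]+s≡s+m : ∀ m → 1 ℕ.* m ℕ.+ s ≡ s ℕ.+ m
        [1*m]+s≡s+m m = trans (ℕ.+-comm (1 ℕ.* m) s) (cong (s ℕ.+_) (ℕ.*-identityˡ m))
        shifted-power : Newton.Poly≤ t (λ m → P^-coeff r (s ℕ.+ m) t)
        shifted-power = Newton.Poly≤-cong (λ m → cong (λ n → P^-coeff r n t) ([1*m]+s≡s+m m))
                                          (Newton-∘affine 1 s (P^-coeff-poly r t))
      term-poly t a t≤d (no a≰d∸t) = Newton.Poly≤-zero _ (λ m →
        trans (cong (coefficient m t *_) (divided-coeff-vanishes (d ℕ.∸ t) a (order m) (ℕ.≰⇒> a≰d∸t))) (*-zeroʳ (coefficient m t)))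

      l-coeff-poly : ∀ a → Monomial.Poly≤ ((d ℕ.+ d) ℕ.∸ a) (l-coeff a)
      l-coeff-poly a with a ℕ.≤? d
      ... | yes a≤d = Monomial.Poly≤-mono (ℕ.≤-reflexive (sym (ℕ.+-∸-assoc d a≤d)))
                        (Newton⇒Monomial (Newton.Poly≤-sum d (λ t t≤d → term-poly t a t≤d (a ℕ.≤? d ℕ.∸ t))))
      ... | no  a≰d = Monomial.Poly≤-zero _ (λ m → l-coeff-vanishes a m (ℕ.≰⇒> a≰d))

      l-coeff-top : ∀ m → l-coeff d m ≡ ℕ→ℚ ((r ℕ.* m ℕ.+ (c₀ ℕ.+ d)) C d)
      l-coeff-top m = begin
        l-coeff d m
          ≡⟨ sumTo-extend {n = d} z≤n (λ t 0<t t≤d → trans (cong (coefficient m t *_)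
               (divided-coeff-vanishes (d ℕ.∸ t) d (order m) (ℕ.∸-monoʳ-< 0<t t≤d))) (*-zeroʳ (coefficient m t))) ⟩
        P^-coeff r (s ℕ.+ m) 0 * 1ℚ * divided-coeff d d (order m)
          ≡⟨ cong₂ (λ b h → b * 1ℚ * h) (P^-coeff-0 r (s ℕ.+ m)) (divided-coeff-diagonal d (order m)) ⟩
        1ℚ * 1ℚ * ℕ→ℚ ((order m ℕ.+ d) C d)
          ≡⟨ *-identityˡ _ ⟩
        ℕ→ℚ ((order m ℕ.+ d) C d)
          ≡⟨ cong (λ n → ℕ→ℚ (n C d)) (ℕ.+-assoc (r ℕ.* m) c₀ d) ⟩
        ℕ→ℚ ((r ℕ.* m ℕ.+ (c₀ ℕ.+ d)) C d) ∎
        where open ≡-Reasoning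

      leading-coeff : ℚ
      leading-coeff = ℕ→ℚ r ^ℚ d * 1/ℕ (d !) {{d ℕ.!≢0}}

      leading-coeff≢0 : leading-coeff ≢ 0ℚ
      leading-coeff≢0 leading≡0 = ℕ→ℚ-*-1/ℕ-≢0 (r ℕ.^ d) (d !) {{ℕ.m^n≢0 r d}} {{d ℕ.!≢0}}
        (trans (cong (_* 1/ℕ (d !) {{d ℕ.!≢0}}) (ℕ→ℚ-homo-^ r d)) leading≡0)

      l-coeff-leading : Monomial.Leading ((d ℕ.+ d) ℕ.∸ d) leading-coeff (l-coeff d)
      l-coeff-leading = subst (λ e → Monomial.Leading e leading-coeff (l-coeff d)) (sym (ℕ.m+n∸n≡m d d))
        (Monomial.Leading-cong (λ m → sym (l-coeff-top m)) (Monomial-C-affine r (c₀ ℕ.+ d) d))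

      expr-isPoly-2d : IsPolyOfDegree (ℤ.+ (d ℕ.+ d)) (expr q r i s η)
      expr-isPoly-2d =
        IsPolyOfDegree-intro (d ℕ.+ d) l-coeff expr-expansion l-coeff-poly (ℕ.m≤m+n d d) l-coeff-leading leading-coeff≢0

    expr-isPoly : IsPolyOfDegree ((2 ℕ.* (r ℕ.* s)) ℤ.⊖ (2 ℕ.* c₀)) (expr q r i s η)
    expr-isPoly with c₀ ℕ.≤? r ℕ.* s
    ... | yes c₀≤rs = subst (λ z → IsPolyOfDegree z (expr q r i s η)) (sym (double-⊖-≥ c₀≤rs)) (expr-isPoly-2d c₀≤rs)
    ... | no  c₀≰rs = subst (λ z → IsPolyOfDegree z (expr q r i s η)) (sym (ℤ.⊖-< 2rs<2c₀))
                            (IsPolyOfDegree-negative (ℕ.m<n⇒0<n∸m 2rs<2c₀) (expr-vanishes (ℕ.≰⇒> c₀≰rs)))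
      where
      2rs<2c₀ : 2 ℕ.* (r ℕ.* s) < 2 ℕ.* c₀
      2rs<2c₀ = ℕ.*-monoʳ-< 2 (ℕ.≰⇒> c₀≰rs)

open import Data.Nat using (ℕ; _<_; _*_; _/_; NonZero)
open import Data.Integer using (+_; _-_)
open import Relation.Binary.PropositionalEquality using (subst; sym)

lemma4p7 : (q r i s η : ℕ) → .{{_ : NonZero q}} → .{{_ : NonZero r}} →
    η < q * r →
    IsPolyOfDegree (+ (2 * r * s) - + (2 * i) - + (2 * (η / q))) (expr q r i s η)
lemma4p7 q r i s η _ =
  subst (λ z → IsPolyOfDegree z (expr q r i s η)) (sym (statement-degree r s i (η / q)))
        (Expression.expr-isPoly q r i s η)
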